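{- Let $L$ be a positive integer, let $\omega_1,\omega_2$ be completely multiplicative complex-valued functions with $\omega_1(p)\omega_2(p)\neq1$ for all primes $p\mid L$, and let $K$ be an arbitrary complex-valued function on the divisors of $L$. For $g\mid L$ define \[ J(g)=\sum_{a\mid g}\sum_{b\mid \frac Lg}\mu(a)\mu(b)\omega_2(a)\omega_1(b)K\Big(\frac{bg}{a}\Big). \] Then for every factorization $L=AB$, \[ K(B)=\Big(\prod_{p\mid L}(1-\omega_1\omega_2(p))^{ -1}\Big)\mathop{\sum_{d\mid A}\sum_{e\mid B}}_{(d,e)=1}\omega_1(d)\omega_2(e)J\Big(\frac{Bd}{e}\Big). \]
   Context: $\mu$ is the Möbius function; the product is over primes $p$ dividing $L$. -}

module Defs where

open import Level using (Level)
open import Algebra.Bundles using (CommutativeRing)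
open import Data.Nat as ℕ using (ℕ; zero; suc)
open import Data.Nat.Divisibility using (_∣?_)
open import Data.Nat.Primality using (prime?)
open import Data.Nat.DivMod using (_/_)
open import Data.List using (List; filter; foldr; map; length; upTo)
open import Data.Bool.ListAction using (and)
open import Data.Bool using (if_then_else_; not)
open import Data.Product using (_×_)
open import Relation.Binary.PropositionalEquality using (_≡_)
open import Relation.Nullary.Decidable using (does)

-- Positive divisors of n, i.e. the d ∈ {1,…,n} with d ∣ n (empty for n = 0).
divisors : ℕ → List ℕ
divisors n = filter (λ d → d ∣? n) (map suc (upTo n))

primeDivisors : ℕ → List ℕ
primeDivisors n = filter prime? (divisors n)

-- Natural-number quotient m / n (only ever used with n a positive divisor of m).
_div_ : ℕ → ℕ → ℕ
m div zero = 0
m div suc n = m / suc n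

squarefree : ℕ → Data.Bool.Bool
squarefree n = and (map (λ p → not (does ((p ℕ.* p) ∣? n))) (primeDivisors n))

module Arith {c ℓ : Level} (R : CommutativeRing c ℓ) where
  open CommutativeRing R public

  sumOver : List ℕ → (ℕ → Carrier) → Carrier
  sumOver xs f = foldr (λ x acc → f x + acc) 0# xs

  prodOver : List ℕ → (ℕ → Carrier) → Carrier
  prodOver xs f = foldr (λ x acc → f x * acc) 1# xs

  Σ∣ : ℕ → (ℕ → Carrier) → Carrier
  Σ∣ n f = sumOver (divisors n) f

  signPow : ℕ → Carrier
  signPow zero = 1#
  signPow (suc k) = - signPow k

  μ : ℕ → Carrier
  μ n = if squarefree n then signPow (length (primeDivisors n)) else 0#

  CompletelyMultiplicative : (ℕ → Carrier) → Set ℓ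
  CompletelyMultiplicative ω =
    (ω 1 ≈ 1#) × (∀ m n → ω (suc m ℕ.* suc n) ≈ ω (suc m) * ω (suc n))

  J : (L : ℕ) → (ω₁ ω₂ K : ℕ → Carrier) → ℕ → Carrier
  J L ω₁ ω₂ K g =
    Σ∣ g (λ a → Σ∣ (L div g) (λ b →
      μ a * μ b * ω₂ a * ω₁ b * K ((b ℕ.* g) div a)))

{-# OPTIONS --safe #-}
-- Both sides are linear in K, and everything is multiplicative in L. For coprime L = L₁L₂ the
-- divisors of L factor uniquely, and μ, ω₁, ω₂ and the indicator of (d, e) = 1 are multiplicative,
-- so J at level L is J at level L₁ applied to J at level L₂ in the second variable, and likewise
-- for the right-hand sum; by induction on coprime factorisations it suffices to treat L = pⁿ.
-- There, with F r = K(pʳ), x = ω₁(p) and y = ω₂(p), only a, b ∈ {1, p} contribute to J, and the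
-- coprime pairs (d, e) are (1, pᵗ) and (pˢ, 1). For A ≠ 1 the two resulting sums Σ yᵗ J(p^(j-t))
-- and Σ xˢ J(p^(j+s)) telescope to F j - x F(j+1) and x F(j+1) - xy F j, whose sum is (1 - xy) F j;
-- for A = 1 the first sum alone telescopes to (1 - xy) F n.
module Submission where

open import Defs
open import Level using (Level; _⊔_)
open import Data.Nat as ℕ using (ℕ; zero; suc; _≤_; _<_; s≤s)
import Data.Nat.Properties as ℕₚ
open import Data.Nat.Divisibility using (_∣_; divides; ∣-trans; *-pres-∣; m∣m*n; n∣m*n; ∣m⇒∣m*n; ∣n⇒∣m*n)
open import Data.Nat.Primality using (Prime; euclidsLemma; ¬prime[1])
open import Data.Nat.Coprimality using (Coprime)
open import Data.Nat.GCD using (gcd; gcd-zeroˡ; gcd-zeroʳ)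
open import Data.Nat.DivMod using (n/1≡n)
open import Algebra.Bundles using (CommutativeMonoid; CommutativeRing)
open import Data.List using (List; []; _∷_; _++_; map; filter; upTo; cartesianProductWith)
open import Data.List.Properties using (map-upTo)
open import Data.List.Membership.Propositional using (_∈_)
open import Data.List.Membership.Propositional.Properties
  using (∈-map⁺; ∈-map⁻; ∈-upTo⁺; ∈-upTo⁻; ∈-++⁺ˡ; ∈-++⁺ʳ; ∈-++⁻; ∈-cartesianProductWith⁺; ∈-cartesianProductWith⁻)
open import Data.List.Membership.Propositional.Properties.WithK using (unique∧set⇒bag)
open import Data.List.Relation.Binary.BagAndSetEquality using (∼bag⇒↭)
open import Data.List.Relation.Binary.Permutation.Propositional as ↭ using (_↭_)
open import Data.List.Relation.Unary.Any using (here; there)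
open import Data.List.Relation.Unary.All as All using ([]; _∷_)
open import Data.List.Relation.Unary.AllPairs using ([]; _∷_)
open import Data.List.Relation.Unary.Unique.Propositional using (Unique)
import Data.List.Relation.Unary.Unique.Propositional.Properties as Unique
open import Data.Bool using (true; false)
open import Data.Product using (_×_; _,_; proj₁; proj₂)
open import Data.Empty using (⊥-elim)
open import Data.Sum using (inj₁; inj₂)
open import Function using (_∘_; _⇔_; mk⇔; Equivalence)
open import Relation.Nullary using (¬_; Dec; yes; no)
open import Relation.Unary using (Pred; Decidable)
open import Relation.Binary.PropositionalEquality as ≡ using (_≡_)

-- Divisors, coprimality and prime powers

module DivisorArithmetic where

  open import Data.Nat using (_+_; _*_; _^_; z≤n; NonZero)
  open import Data.Nat.Properties
  open import Data.Nat.Divisibility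
  open import Data.Nat.Coprimality as Coprime using (coprime-divisor)
  open import Data.Nat.GCD using (gcd[m,n]∣m; gcd[m,n]∣n; gcd-greatest; gcd[m,n]≡0⇒n≡0)
  open import Data.Nat.Primality using (prime?; prime⇒irreducible; prime⇒nonZero)
  open import Data.Nat.Primality.Factorisation using (factorise)
  open import Data.Nat.DivMod using (m*n/n≡m; /-*-interchange; m*[n/m]≡n; /-congˡ; *-/-assoc)
  open import Data.Nat.Induction using (<-rec)
  open import Data.Nat.ListAction using (product)
  open import Data.List.Membership.Propositional.Properties using (∈-filter⁺; ∈-filter⁻)
  open import Data.List.Relation.Unary.All.Properties using (all⁺; all⁻)
  open import Data.Product using (∃; ∃₂)
  open import Data.Bool using (Bool; T; not)
  open import Data.Bool.Properties using (T?)
  open import Data.Unit using (tt)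
  open import Relation.Nullary.Decidable as Dec using (does)
  open import Relation.Binary.PropositionalEquality
  open import Relation.Binary.Definitions using (tri<; tri≈; tri>)
  open import Algebra.Properties.CommutativeSemigroup *-commutativeSemigroup using (xy∙z≈xz∙y; x∙yz≈y∙xz; interchange)

  private
    variable
      a b d m n p : ℕ

  ∣-pos : 0 < n → d ∣ n → 0 < d
  ∣-pos {d = zero} 0<n d∣n = ⊥-elim (<⇒≢ 0<n (sym (0∣⇒≡0 d∣n)))
  ∣-pos {d = suc d} 0<n d∣n = s≤s z≤n

  m*n>0 : 0 < m → 0 < n → 0 < m * n
  m*n>0 {suc m} {suc n} _ _ = s≤s z≤n

  ∈-divisors⁺ : 0 < n → d ∣ n → d ∈ divisors n
  ∈-divisors⁺ {n} {zero} 0<n d∣n = ⊥-elim (<⇒≢ 0<n (sym (0∣⇒≡0 d∣n)))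
  ∈-divisors⁺ {suc n} {suc d} 0<n d∣n = ∈-filter⁺ (_∣? suc n) (∈-map⁺ suc (∈-upTo⁺ (∣⇒≤ d∣n))) d∣n

  ∈-divisors⁻ : ∀ n → d ∈ divisors n → d ∣ n × 0 < d
  ∈-divisors⁻ n d∈ with ∈-filter⁻ (_∣? n) {xs = map suc (upTo n)} d∈
  ... | d∈′ , d∣n with ∈-map⁻ suc d∈′
  ... | _ , _ , refl = d∣n , s≤s z≤n

  unique-divisors : ∀ n → Unique (divisors n)
  unique-divisors n = Unique.filter⁺ (_∣? n) (Unique.map⁺ suc-injective (Unique.upTo⁺ n))

  ∈-primeDivisors⁺ : 0 < n → Prime p → p ∣ n → p ∈ primeDivisors n
  ∈-primeDivisors⁺ 0<n pp p∣n = ∈-filter⁺ prime? (∈-divisors⁺ 0<n p∣n) pp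

  ∈-primeDivisors⁻ : ∀ n → p ∈ primeDivisors n → Prime p × p ∣ n
  ∈-primeDivisors⁻ n p∈ with ∈-filter⁻ prime? {xs = divisors n} p∈
  ... | p∈′ , pp = pp , proj₁ (∈-divisors⁻ n p∈′)

  unique-primeDivisors : ∀ n → Unique (primeDivisors n)
  unique-primeDivisors n = Unique.filter⁺ prime? (unique-divisors n)

  coprime-∣-∣ : Coprime m n → a ∣ m → b ∣ n → Coprime a b
  coprime-∣-∣ m⊥n a∣m b∣n (i∣a , i∣b) = m⊥n (∣-trans i∣a a∣m , ∣-trans i∣b b∣n)

  coprime-*ˡ : Coprime m d → Coprime n d → Coprime (m * n) d
  coprime-*ˡ {m} {d} {n} m⊥d n⊥d {i} (i∣mn , i∣d) = n⊥d (coprime-divisor i⊥m i∣mn , i∣d)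
    where
    i⊥m : Coprime i m
    i⊥m (j∣i , j∣m) = m⊥d (j∣m , ∣-trans j∣i i∣d)

  coprime-*ʳ : Coprime d m → Coprime d n → Coprime d (m * n)
  coprime-*ʳ d⊥m d⊥n = Coprime.sym (coprime-*ˡ (Coprime.sym d⊥m) (Coprime.sym d⊥n))

  -- With g = gcd d m, write d = q g and m = r g; then q and r are coprime and q ∣ r n forces q ∣ n.
  coprime-∣*-split : Coprime m n → 0 < m → d ∣ m * n → ∃₂ λ a b → a ∣ m × b ∣ n × d ≡ a * b
  coprime-∣*-split {m} {n} {d} m⊥n 0<m d∣mn
    with gcd[m,n]∣m d m | gcd[m,n]∣n d m
  ... | divides q d≡qg | divides r m≡rg = g , q , gcd[m,n]∣n d m , q∣n , trans d≡qg (*-comm q g)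
    where
    g = gcd d m
    instance
      g≢0 : NonZero g
      g≢0 = ℕ.≢-nonZero (λ g≡0 → <⇒≢ 0<m (sym (gcd[m,n]≡0⇒n≡0 d g≡0)))
    q⊥r : Coprime q r
    q⊥r {i} (i∣q , i∣r) = ∣1⇒≡1 (*-cancelʳ-∣ g (subst (i * g ∣_) (sym (*-identityˡ g))
      (gcd-greatest (subst (i * g ∣_) (sym d≡qg) (*-monoˡ-∣ g i∣q))
                    (subst (i * g ∣_) (sym m≡rg) (*-monoˡ-∣ g i∣r)))))
    q∣rn : q ∣ r * n
    q∣rn = *-cancelʳ-∣ g (subst₂ _∣_ d≡qg (trans (cong (_* n) m≡rg) (xy∙z≈xz∙y r g n)) d∣mn)
    q∣n : q ∣ n
    q∣n = coprime-divisor q⊥r q∣rn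

  coprime-*-injectiveˡ : ∀ {a′ b b′} → Coprime m n → a ∣ m → a′ ∣ m → b ∣ n → b′ ∣ n →
    a * b ≡ a′ * b′ → a ≡ a′
  coprime-*-injectiveˡ {a = a} {a′} {b} {b′} m⊥n a∣m a′∣m b∣n b′∣n ab≡a′b′ = ∣-antisym
    (coprime-divisor (coprime-∣-∣ m⊥n a∣m b′∣n) (subst (a ∣_) (trans ab≡a′b′ (*-comm a′ b′)) (m∣m*n b)))
    (coprime-divisor (coprime-∣-∣ m⊥n a′∣m b∣n) (subst (a′ ∣_) (trans (sym ab≡a′b′) (*-comm a b)) (m∣m*n b′)))

  gcd-*-≡1⇔ : ∀ {L₁ L₂ d₁ d₂ e₁ e₂} → Coprime L₁ L₂ → d₁ ∣ L₁ → e₁ ∣ L₁ → d₂ ∣ L₂ → e₂ ∣ L₂ →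
    gcd (d₁ * d₂) (e₁ * e₂) ≡ 1 ⇔ (gcd d₁ e₁ ≡ 1 × gcd d₂ e₂ ≡ 1)
  gcd-*-≡1⇔ {d₁ = d₁} {d₂} {e₁} {e₂} L₁⊥L₂ d₁∣L₁ e₁∣L₁ d₂∣L₂ e₂∣L₂ = mk⇔
    (λ gcd≡1 → let d⊥e = Coprime.gcd≡1⇒coprime {d₁ * d₂} {e₁ * e₂} gcd≡1 in
       Coprime.coprime⇒gcd≡1 {d₁} {e₁} (coprime-∣-∣ d⊥e (m∣m*n d₂) (m∣m*n e₂)) ,
       Coprime.coprime⇒gcd≡1 {d₂} {e₂} (coprime-∣-∣ d⊥e (n∣m*n d₁) (n∣m*n e₁)))
    (λ (gcd₁≡1 , gcd₂≡1) → Coprime.coprime⇒gcd≡1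
       (coprime-*ʳ (coprime-*ˡ (Coprime.gcd≡1⇒coprime {d₁} {e₁} gcd₁≡1) (coprime-∣-∣ (Coprime.sym L₁⊥L₂) d₂∣L₂ e₁∣L₁))
                   (coprime-*ˡ (coprime-∣-∣ L₁⊥L₂ d₁∣L₁ e₂∣L₂) (Coprime.gcd≡1⇒coprime {d₂} {e₂} gcd₂≡1))))

  prime>1 : Prime p → 1 < p
  prime>1 {0} ()
  prime>1 {1} ()
  prime>1 {suc (suc p)} _ = s≤s (s≤s z≤n)

  prime>0 : Prime p → 0 < p
  prime>0 pp = <⇒≤ (prime>1 pp)

  p^k>0 : ∀ k → Prime p → 0 < p ^ k
  p^k>0 {p} k pp = m^n>0 p {{prime⇒nonZero pp}} k

  ^-injectiveʳ : ∀ {i j} → 1 < p → p ^ i ≡ p ^ j → i ≡ j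
  ^-injectiveʳ {p} {i} {j} 1<p p^i≡p^j with <-cmp i j
  ... | tri< i<j _ _ = ⊥-elim (<⇒≢ (^-monoʳ-< p 1<p i<j) p^i≡p^j)
  ... | tri≈ _ i≡j _ = i≡j
  ... | tri> _ _ j<i = ⊥-elim (<⇒≢ (^-monoʳ-< p 1<p j<i) (sym p^i≡p^j))

  prime∤⇒coprime : Prime p → ¬ p ∣ n → Coprime p n
  prime∤⇒coprime pp p∤n (i∣p , i∣n) with prime⇒irreducible pp i∣p
  ... | inj₁ i≡1 = i≡1
  ... | inj₂ refl = ⊥-elim (p∤n i∣n)

  ∣p^k⇒≡p^i : Prime p → ∀ k → d ∣ p ^ k → ∃ λ i → i ≤ k × d ≡ p ^ i
  ∣p^k⇒≡p^i pp zero d∣1 = 0 , z≤n , ∣1⇒≡1 d∣1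
  ∣p^k⇒≡p^i {p} {d} pp (suc k) d∣p^k+1 with p ∣? d
  ... | yes (divides d′ refl) =
    let d′p∣p^kp = subst (d′ * p ∣_) (*-comm p (p ^ k)) d∣p^k+1
        (i , i≤k , d′≡p^i) = ∣p^k⇒≡p^i pp k (*-cancelʳ-∣ p {{prime⇒nonZero pp}} d′p∣p^kp)
    in suc i , s≤s i≤k , trans (*-comm d′ p) (cong (p *_) d′≡p^i)
  ... | no p∤d =
    let (i , i≤k , d≡p^i) = ∣p^k⇒≡p^i pp k (coprime-divisor (Coprime.sym (prime∤⇒coprime pp p∤d)) d∣p^k+1)
    in i , m≤n⇒m≤1+n i≤k , d≡p^i

  p^i∣p^k : ∀ {i k} → i ≤ k → p ^ i ∣ p ^ k
  p^i∣p^k {p} {i} {k} i≤k = divides (p ^ (k ℕ.∸ i))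
    (trans (cong (p ^_) (sym (m+[n∸m]≡n i≤k))) (trans (^-distribˡ-+-* p i (k ℕ.∸ i)) (*-comm (p ^ i) _)))

  prime∣p^k⇒≡p : ∀ {p q} k → Prime p → Prime q → q ∣ p ^ k → q ≡ p
  prime∣p^k⇒≡p {p} k pp pq q∣p^k with ∣p^k⇒≡p^i pp k q∣p^k
  ... | zero , _ , refl = ⊥-elim (¬prime[1] pq)
  ... | suc i , _ , q≡p^i+1 with prime⇒irreducible pq (subst (p ∣_) (sym q≡p^i+1) (m∣m*n (p ^ i)))
  ...   | inj₁ refl = ⊥-elim (¬prime[1] pp)
  ...   | inj₂ p≡q = sym p≡q

  coprime-^ : ∀ k → Prime p → ¬ p ∣ n → Coprime (p ^ k) n
  coprime-^ k pp p∤n (i∣p^k , i∣n) with ∣p^k⇒≡p^i pp k i∣p^k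
  ... | zero , _ , i≡1 = i≡1
  ... | suc j , _ , refl = ⊥-elim (p∤n (∣-trans (m∣m*n _) i∣n))

  gcd[p^[1+s],p^[1+t]]≢1 : ∀ s t → Prime p → gcd (p ^ suc s) (p ^ suc t) ≢ 1
  gcd[p^[1+s],p^[1+t]]≢1 {p} s t pp gcd≡1 =
    ¬prime[1] (subst Prime (Coprime.gcd≡1⇒coprime gcd≡1 (m∣m*n (p ^ s) , m∣m*n (p ^ t))) pp)

  m*n-div-m≡n : ∀ {m} n → 0 < m → (m * n) div m ≡ n
  m*n-div-m≡n {suc m} n _ = trans (/-congˡ (*-comm (suc m) n)) (m*n/n≡m n (suc m))

  m*[n-div-m]≡n : ∀ {m n} → 0 < m → m ∣ n → m * (n div m) ≡ n
  m*[n-div-m]≡n {suc m} _ m∣n = m*[n/m]≡n m∣n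

  n-div-m∣n : ∀ {m n} → 0 < m → m ∣ n → n div m ∣ n
  n-div-m∣n {m} 0<m m∣n = divides m (sym (m*[n-div-m]≡n 0<m m∣n))

  div-*-interchange : ∀ {a b c d} → 0 < c → 0 < d → c ∣ a → d ∣ b → (a * b) div (c * d) ≡ (a div c) * (b div d)
  div-*-interchange {c = suc c} {suc d} _ _ c∣a d∣b = /-*-interchange c∣a d∣b

  div-*-interchange² : ∀ {x₁ x₂ y₁ y₂ z₁ z₂} → 0 < x₁ → 0 < x₂ → x₁ ∣ y₁ * z₁ → x₂ ∣ y₂ * z₂ →
    ((y₁ * y₂) * (z₁ * z₂)) div (x₁ * x₂) ≡ ((y₁ * z₁) div x₁) * ((y₂ * z₂) div x₂)
  div-*-interchange² {x₁} {x₂} {y₁} {y₂} {z₁} {z₂} 0<x₁ 0<x₂ x₁∣ x₂∣ =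
    trans (cong (_div (x₁ * x₂)) (interchange y₁ y₂ z₁ z₂)) (div-*-interchange 0<x₁ 0<x₂ x₁∣ x₂∣)

  [n*d]-div-e∣m*n : ∀ {m n d e} → 0 < e → e ∣ n → d ∣ m → (n * d) div e ∣ m * n
  [n*d]-div-e∣m*n {m} {n} {d} {suc e} _ e∣n d∣m =
    subst (_∣ m * n) (trans (sym (*-/-assoc d e∣n)) (/-congˡ (*-comm d n))) (*-pres-∣ d∣m (m/n∣m e∣n))

  [a*b]*c≡m*n⇒c≡[m-div-a]*[n-div-b] : ∀ {a₁ a₂ n₁ n₂ b} → 0 < a₁ → 0 < a₂ → a₁ ∣ n₁ → a₂ ∣ n₂ →
    (a₁ * a₂) * b ≡ n₁ * n₂ → b ≡ (n₁ div a₁) * (n₂ div a₂)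
  [a*b]*c≡m*n⇒c≡[m-div-a]*[n-div-b] {a₁} {a₂} {n₁} {n₂} {b} 0<a₁ 0<a₂ a₁∣n₁ a₂∣n₂ a₁a₂b≡n₁n₂ =
    *-cancelˡ-≡ b _ (a₁ * a₂) {{ℕ.>-nonZero (m*n>0 0<a₁ 0<a₂)}}
      (trans a₁a₂b≡n₁n₂ (trans (cong₂ _*_ (sym (m*[n-div-m]≡n 0<a₁ a₁∣n₁)) (sym (m*[n-div-m]≡n 0<a₂ a₂∣n₂)))
                               (interchange a₁ _ a₂ _)))

  p^t*p^[s+r]-div-p^s : ∀ t r s → Prime p → (p ^ t * p ^ (s + r)) div (p ^ s) ≡ p ^ (t + r)
  p^t*p^[s+r]-div-p^s {p} t r s pp = trans (cong (_div (p ^ s)) shuffle) (m*n-div-m≡n (p ^ (t + r)) (p^k>0 s pp))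
    where
    shuffle : p ^ t * p ^ (s + r) ≡ p ^ s * p ^ (t + r)
    shuffle = begin
      p ^ t * p ^ (s + r)     ≡⟨ cong (p ^ t *_) (^-distribˡ-+-* p s r) ⟩
      p ^ t * (p ^ s * p ^ r) ≡⟨ x∙yz≈y∙xz (p ^ t) (p ^ s) (p ^ r) ⟩
      p ^ s * (p ^ t * p ^ r) ≡⟨ cong (p ^ s *_) (^-distribˡ-+-* p t r) ⟨
      p ^ s * p ^ (t + r)     ∎
      where open ≡-Reasoning

  SquareFree : ℕ → Set
  SquareFree n = ∀ {p} → p ∈ primeDivisors n → ¬ p * p ∣ n

  T-not-does⇔¬ : ∀ {ℓ} {P : Set ℓ} (P? : Dec P) → T (not (does P?)) ⇔ (¬ P)
  T-not-does⇔¬ (yes P) = mk⇔ (λ ()) (λ ¬P → ¬P P)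
  T-not-does⇔¬ (no ¬P) = mk⇔ (λ _ → ¬P) (λ _ → tt)

  squarefree⇔SquareFree : ∀ n → T (squarefree n) ⇔ SquareFree n
  squarefree⇔SquareFree n = mk⇔
    (λ sf {p} p∈ → Equivalence.to (T-not-does⇔¬ (p * p ∣? n)) (All.lookup (all⁺ φ (primeDivisors n) sf) p∈))
    (λ sf → all⁻ φ (All.tabulate (λ {p} p∈ → Equivalence.from (T-not-does⇔¬ (p * p ∣? n)) (sf p∈))))
    where
    φ : ℕ → Bool
    φ p = not (does ((p * p) ∣? n))

  SquareFree? : ∀ n → Dec (SquareFree n)
  SquareFree? n = Dec.map (squarefree⇔SquareFree n) (T? (squarefree n))

  SquareFree-coprime-* : Coprime m n → 0 < m → 0 < n → SquareFree (m * n) ⇔ (SquareFree m × SquareFree n)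
  SquareFree-coprime-* {m} {n} m⊥n 0<m 0<n = mk⇔ to from
    where
    0<mn = m*n>0 0<m 0<n
    square-coprime : Coprime p d → Coprime (p * p) d
    square-coprime p⊥d = coprime-*ˡ p⊥d p⊥d
    to : SquareFree (m * n) → SquareFree m × SquareFree n
    to sf = (λ {p} p∈ p²∣m → let (pp , p∣m) = ∈-primeDivisors⁻ m p∈ in
               sf (∈-primeDivisors⁺ 0<mn pp (∣m⇒∣m*n n p∣m)) (∣m⇒∣m*n n p²∣m))
          , (λ {p} p∈ p²∣n → let (pp , p∣n) = ∈-primeDivisors⁻ n p∈ in
               sf (∈-primeDivisors⁺ 0<mn pp (∣n⇒∣m*n m p∣n)) (∣n⇒∣m*n m p²∣n))
    from : SquareFree m × SquareFree n → SquareFree (m * n)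
    from (sfm , sfn) {p} p∈ p²∣mn with ∈-primeDivisors⁻ (m * n) p∈
    ... | pp , p∣mn with euclidsLemma m n pp p∣mn
    ... | inj₁ p∣m = sfm (∈-primeDivisors⁺ 0<m pp p∣m)
      (coprime-divisor (square-coprime (coprime-∣-∣ m⊥n p∣m ∣-refl)) (subst (p * p ∣_) (*-comm m n) p²∣mn))
    ... | inj₂ p∣n = sfn (∈-primeDivisors⁺ 0<n pp p∣n)
      (coprime-divisor (square-coprime (coprime-∣-∣ (Coprime.sym m⊥n) p∣n ∣-refl)) p²∣mn)

  SquareFree-p^1 : Prime p → SquareFree (p ^ 1)
  SquareFree-p^1 {p} pp {q} q∈ q²∣p with ∈-primeDivisors⁻ (p ^ 1) q∈
  ... | pq , q∣p rewrite prime∣p^k⇒≡p 1 pp pq q∣p =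
    ¬prime[1] (subst Prime (∣1⇒≡1 (*-cancelˡ-∣ p {{prime⇒nonZero pp}} q²∣p)) pp)

  ¬SquareFree-p^[2+k] : ∀ k → Prime p → ¬ SquareFree (p ^ (2 + k))
  ¬SquareFree-p^[2+k] {p} k pp sf =
    sf (∈-primeDivisors⁺ (p^k>0 (2 + k) pp) pp (m∣m*n (p ^ (1 + k))))
       (divides (p ^ k) (trans (sym (*-assoc p p (p ^ k))) (*-comm (p * p) (p ^ k))))

  ∃prime-∣ : 1 < n → ∃ λ p → Prime p × p ∣ n
  ∃prime-∣ {1} (s≤s ())
  ∃prime-∣ {suc (suc n)} _ with factorise (suc (suc n))
  ... | record { factors = [] ; isFactorisation = () }
  ... | record { factors = p ∷ ps ; isFactorisation = n≡Π ; factorsPrime = pp ∷ _ } =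
    p , pp , subst (p ∣_) (sym n≡Π) (m∣m*n (product ps))

  p-free-part : Prime p → ∀ n → 0 < n → ∃₂ λ k M → n ≡ p ^ k * M × ¬ p ∣ M
  p-free-part {p} pp = <-rec _ go
    where
    go : ∀ n → (∀ {m} → m < n → 0 < m → ∃₂ λ k M → m ≡ p ^ k * M × ¬ p ∣ M) →
         0 < n → ∃₂ λ k M → n ≡ p ^ k * M × ¬ p ∣ M
    go n rec 0<n with p ∣? n
    ... | no p∤n = 0 , n , sym (+-identityʳ n) , p∤n
    ... | yes (divides q n≡qp) =
      let (k , M , q≡p^kM , p∤M) = rec q<n 0<q
      in suc k , M , trans n≡qp (trans (*-comm q p) (trans (cong (p *_) q≡p^kM) (sym (*-assoc p (p ^ k) M)))) , p∤M
      where
      0<q : 0 < q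
      0<q = ∣-pos 0<n (divides p (trans n≡qp (*-comm q p)))
      q<n : q < n
      q<n = subst (q <_) (sym n≡qp) (m<m*n q p {{ℕ.>-nonZero 0<q}} (prime>1 pp))

  coprime-induction : ∀ {ℓ} (P : ℕ → Set ℓ) → P 1 → (∀ {p} k → Prime p → P (p ^ suc k)) →
    (∀ {m n} → Coprime m n → 0 < m → 0 < n → P m → P n → P (m * n)) → ∀ n → 0 < n → P n
  coprime-induction P P1 Pp^k P* = <-rec _ go
    where
    go : ∀ n → (∀ {m} → m < n → 0 < m → P m) → 0 < n → P n
    go 1 rec _ = P1
    go n@(suc (suc _)) rec 0<n with ∃prime-∣ {n} (s≤s (s≤s z≤n))
    ... | p , pp , p∣n with p-free-part pp n 0<n
    ...   | zero , M , n≡M , p∤M = ⊥-elim (p∤M (subst (p ∣_) (trans n≡M (+-identityʳ M)) p∣n))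
    ...   | suc k , M , n≡p^kM , p∤M =
      subst P (sym n≡p^kM) (P* (coprime-^ (suc k) pp p∤M) (p^k>0 (suc k) pp) 0<M (Pp^k k pp) (rec M<n 0<M))
      where
      0<M : 0 < M
      0<M = ∣-pos 0<n (divides (p ^ suc k) n≡p^kM)
      M<n : M < n
      M<n = subst (M <_) (trans (*-comm M _) (sym n≡p^kM))
        (m<m*n M (p ^ suc k) {{ℕ.>-nonZero 0<M}} (^-monoʳ-< p (prime>1 pp) {0} {suc k} (s≤s z≤n)))

open DivisorArithmetic

private
  variable
    a b : Level
    A B : Set a

map-injectiveOn⁺ : {xs : List A} (f : A → B) →
  (∀ {x y} → x ∈ xs → y ∈ xs → f x ≡ f y → x ≡ y) → Unique xs → Unique (map f xs)
map-injectiveOn⁺ f inj [] = []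
map-injectiveOn⁺ f inj (x∉xs ∷ xs!) =
  All.tabulate (λ fy∈ fx≡fy → let (y , y∈ , fy≡) = ∈-map⁻ f fy∈ in
                  All.lookup x∉xs y∈ (inj (here ≡.refl) (there y∈) (≡.trans fx≡fy fy≡)))
  ∷ map-injectiveOn⁺ f (λ x∈ y∈ → inj (there x∈) (there y∈)) xs!

cartesianProductWith-injectiveOn⁺ : {C : Set a} {xs : List A} {ys : List B} (f : A → B → C) →
  (∀ {x x′ y y′} → x ∈ xs → x′ ∈ xs → y ∈ ys → y′ ∈ ys → f x y ≡ f x′ y′ → x ≡ x′ × y ≡ y′) →
  Unique xs → Unique ys → Unique (cartesianProductWith f xs ys)
cartesianProductWith-injectiveOn⁺ f inj [] ys! = []
cartesianProductWith-injectiveOn⁺ {xs = x ∷ xs} {ys} f inj (x∉xs ∷ xs!) ys! =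
  Unique.++⁺ (map-injectiveOn⁺ (f x) (λ y∈ y′∈ → proj₂ ∘ inj (here ≡.refl) (here ≡.refl) y∈ y′∈) ys!)
    (cartesianProductWith-injectiveOn⁺ f (λ x∈ x′∈ → inj (there x∈) (there x′∈)) xs! ys!)
    disjoint
  where
  disjoint : ∀ {v} → ¬ (v ∈ map (f x) ys × v ∈ cartesianProductWith f xs ys)
  disjoint (v∈ , v∈′) with ∈-map⁻ (f x) v∈ | ∈-cartesianProductWith⁻ f xs ys v∈′
  ... | y , y∈ , ≡.refl | x′ , y′ , x′∈ , y′∈ , fxy≡ =
    All.lookup x∉xs x′∈ (proj₁ (inj (here ≡.refl) (there x′∈) y∈ y′∈ fxy≡))

-- Finite sums over duplicate-free lists

module BigOperator {c ℓ} (M : CommutativeMonoid c ℓ) where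
  open CommutativeMonoid M
  open import Algebra.Properties.CommutativeSemigroup commutativeSemigroup using (interchange)
  open import Relation.Binary.Reasoning.Setoid setoid

  fold : List A → (A → Carrier) → Carrier
  fold xs f = Data.List.foldr (λ x acc → f x ∙ acc) ε xs

  fold-cong : ∀ (xs : List A) {f g} → (∀ {x} → x ∈ xs → f x ≈ g x) → fold xs f ≈ fold xs g
  fold-cong [] f≈g = refl
  fold-cong (x ∷ xs) f≈g = ∙-cong (f≈g (here ≡.refl)) (fold-cong xs (f≈g ∘ there))

  fold-↭ : ∀ {xs ys : List A} f → xs ↭ ys → fold xs f ≈ fold ys f
  fold-↭ f ↭.refl = refl
  fold-↭ f (↭.prep x p) = ∙-congˡ (fold-↭ f p)
  fold-↭ f (↭.swap {xs} {ys} x y p) = begin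
    f x ∙ (f y ∙ fold xs f) ≈⟨ assoc _ _ _ ⟨
    (f x ∙ f y) ∙ fold xs f ≈⟨ ∙-cong (comm _ _) (fold-↭ f p) ⟩
    (f y ∙ f x) ∙ fold ys f ≈⟨ assoc _ _ _ ⟩
    f y ∙ (f x ∙ fold ys f) ∎
  fold-↭ f (↭.trans p q) = trans (fold-↭ f p) (fold-↭ f q)

  fold-∈⇔ : ∀ {xs ys : List A} f → Unique xs → Unique ys →
    (∀ {z} → z ∈ xs ⇔ z ∈ ys) → fold xs f ≈ fold ys f
  fold-∈⇔ f xs! ys! xs∼ys = fold-↭ f (∼bag⇒↭ (unique∧set⇒bag xs! ys! xs∼ys))

  fold-++ : ∀ (xs ys : List A) f → fold (xs ++ ys) f ≈ fold xs f ∙ fold ys f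
  fold-++ [] ys f = sym (identityˡ _)
  fold-++ (x ∷ xs) ys f = trans (∙-congˡ (fold-++ xs ys f)) (sym (assoc _ _ _))

  fold-map : ∀ (g : B → A) xs f → fold (map g xs) f ≈ fold xs (f ∘ g)
  fold-map g [] f = refl
  fold-map g (x ∷ xs) f = ∙-congˡ (fold-map g xs f)

  fold-cartesianProductWith : ∀ {C : Set a} (g : A → B → C) xs ys f →
    fold (cartesianProductWith g xs ys) f ≈ fold xs (λ x → fold ys (λ y → f (g x y)))
  fold-cartesianProductWith g [] ys f = refl
  fold-cartesianProductWith g (x ∷ xs) ys f = begin
    fold (map (g x) ys ++ cartesianProductWith g xs ys) f
      ≈⟨ fold-++ (map (g x) ys) _ f ⟩
    fold (map (g x) ys) f ∙ fold (cartesianProductWith g xs ys) f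
      ≈⟨ ∙-cong (fold-map (g x) ys f) (fold-cartesianProductWith g xs ys f) ⟩
    fold ys (f ∘ g x) ∙ fold xs (λ x → fold ys (λ y → f (g x y))) ∎

  fold-ε : ∀ (xs : List A) → fold xs (λ _ → ε) ≈ ε
  fold-ε [] = refl
  fold-ε (x ∷ xs) = trans (identityˡ _) (fold-ε xs)

  fold-∙ : ∀ (xs : List A) f g → fold xs (λ x → f x ∙ g x) ≈ fold xs f ∙ fold xs g
  fold-∙ [] f g = sym (identityˡ ε)
  fold-∙ (x ∷ xs) f g = trans (∙-congˡ (fold-∙ xs f g)) (interchange _ _ _ _)

  fold-comm : ∀ (xs : List A) (ys : List B) (f : A → B → Carrier) →
    fold xs (λ x → fold ys (λ y → f x y)) ≈ fold ys (λ y → fold xs (λ x → f x y))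
  fold-comm [] ys f = sym (fold-ε ys)
  fold-comm (x ∷ xs) ys f =
    trans (∙-congˡ (fold-comm xs ys f)) (sym (fold-∙ ys (f x) (λ y → fold xs (λ x → f x y))))

module DivisorFold {c ℓ} (M : CommutativeMonoid c ℓ) where
  open CommutativeMonoid M
  open BigOperator M public
  open import Relation.Binary.Reasoning.Setoid setoid

  fold-divisors-coprime-* : ∀ {m n} → Coprime m n → 0 < m → 0 < n → ∀ f →
    fold (divisors (m ℕ.* n)) f ≈ fold (divisors m) (λ a → fold (divisors n) (λ b → f (a ℕ.* b)))
  fold-divisors-coprime-* {m} {n} m⊥n 0<m 0<n f = begin
    fold (divisors (m ℕ.* n)) f  ≈⟨ fold-∈⇔ f (unique-divisors (m ℕ.* n)) unique-pairs (mk⇔ to from) ⟩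
    fold pairs f                 ≈⟨ fold-cartesianProductWith ℕ._*_ (divisors m) (divisors n) f ⟩
    fold (divisors m) (λ a → fold (divisors n) (λ b → f (a ℕ.* b))) ∎
    where
    pairs = cartesianProductWith ℕ._*_ (divisors m) (divisors n)
    unique-pairs : Unique pairs
    unique-pairs = cartesianProductWith-injectiveOn⁺ ℕ._*_ injective (unique-divisors m) (unique-divisors n)
      where
      injective : ∀ {a a′ b b′} → a ∈ divisors m → a′ ∈ divisors m → b ∈ divisors n → b′ ∈ divisors n →
        a ℕ.* b ≡ a′ ℕ.* b′ → a ≡ a′ × b ≡ b′
      injective a∈ a′∈ b∈ b′∈ ab≡a′b′
        with (a∣m , 0<a) ← ∈-divisors⁻ m a∈ | (a′∣m , _) ← ∈-divisors⁻ m a′∈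
        with (b∣n , _) ← ∈-divisors⁻ n b∈ | (b′∣n , _) ← ∈-divisors⁻ n b′∈
        with ≡.refl ← coprime-*-injectiveˡ m⊥n a∣m a′∣m b∣n b′∣n ab≡a′b′
        = ≡.refl , ℕₚ.*-cancelˡ-≡ _ _ _ {{ℕ.>-nonZero 0<a}} ab≡a′b′
    to : ∀ {d} → d ∈ divisors (m ℕ.* n) → d ∈ pairs
    to d∈ with coprime-∣*-split m⊥n 0<m (proj₁ (∈-divisors⁻ (m ℕ.* n) d∈))
    ... | a , b , a∣m , b∣n , ≡.refl = ∈-cartesianProductWith⁺ ℕ._*_ (∈-divisors⁺ 0<m a∣m) (∈-divisors⁺ 0<n b∣n)
    from : ∀ {d} → d ∈ pairs → d ∈ divisors (m ℕ.* n)
    from d∈ with ∈-cartesianProductWith⁻ ℕ._*_ (divisors m) (divisors n) d∈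
    ... | a , b , a∈ , b∈ , ≡.refl =
      ∈-divisors⁺ (m*n>0 0<m 0<n) (*-pres-∣ (proj₁ (∈-divisors⁻ m a∈)) (proj₁ (∈-divisors⁻ n b∈)))

  fold-divisors-cong : ∀ n {f g} → (∀ {d} → d ∣ n → f d ≈ g d) → fold (divisors n) f ≈ fold (divisors n) g
  fold-divisors-cong n f≈g = fold-cong (divisors n) (λ {d} d∈ → f≈g (proj₁ (∈-divisors⁻ n d∈)))

  fold-divisors²-coprime-* : ∀ {X₁ X₂ Y₁ Y₂} → Coprime X₁ X₂ → Coprime Y₁ Y₂ →
    0 < X₁ → 0 < X₂ → 0 < Y₁ → 0 < Y₂ → ∀ (f : ℕ → ℕ → Carrier) (g : ℕ → ℕ → ℕ → ℕ → Carrier) →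
    (∀ {x₁ x₂ y₁ y₂} → x₁ ∣ X₁ → x₂ ∣ X₂ → y₁ ∣ Y₁ → y₂ ∣ Y₂ → f (x₁ ℕ.* x₂) (y₁ ℕ.* y₂) ≈ g x₁ y₁ x₂ y₂) →
    fold (divisors (X₁ ℕ.* X₂)) (λ x → fold (divisors (Y₁ ℕ.* Y₂)) (f x)) ≈
    fold (divisors X₁) (λ x₁ → fold (divisors Y₁) (λ y₁ →
      fold (divisors X₂) (λ x₂ → fold (divisors Y₂) (g x₁ y₁ x₂))))
  fold-divisors²-coprime-* {X₁} {X₂} {Y₁} {Y₂} X₁⊥X₂ Y₁⊥Y₂ 0<X₁ 0<X₂ 0<Y₁ 0<Y₂ f g f≈g = begin
    fold (divisors (X₁ ℕ.* X₂)) (λ x → fold (divisors (Y₁ ℕ.* Y₂)) (f x))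
      ≈⟨ fold-divisors-coprime-* X₁⊥X₂ 0<X₁ 0<X₂ _ ⟩
    ∑ X₁ (λ x₁ → ∑ X₂ (λ x₂ → fold (divisors (Y₁ ℕ.* Y₂)) (f (x₁ ℕ.* x₂))))
      ≈⟨ fold-divisors-cong X₁ (λ _ → fold-divisors-cong X₂ (λ _ → fold-divisors-coprime-* Y₁⊥Y₂ 0<Y₁ 0<Y₂ _)) ⟩
    ∑ X₁ (λ x₁ → ∑ X₂ (λ x₂ → ∑ Y₁ (λ y₁ → ∑ Y₂ (λ y₂ → f (x₁ ℕ.* x₂) (y₁ ℕ.* y₂)))))
      ≈⟨ fold-divisors-cong X₁ (λ x₁∣ → fold-divisors-cong X₂ (λ x₂∣ →
           fold-divisors-cong Y₁ (λ y₁∣ → fold-divisors-cong Y₂ (λ y₂∣ → f≈g x₁∣ x₂∣ y₁∣ y₂∣)))) ⟩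
    ∑ X₁ (λ x₁ → ∑ X₂ (λ x₂ → ∑ Y₁ (λ y₁ → ∑ Y₂ (g x₁ y₁ x₂))))
      ≈⟨ fold-divisors-cong X₁ (λ _ → fold-comm (divisors X₂) (divisors Y₁) _) ⟩
    ∑ X₁ (λ x₁ → ∑ Y₁ (λ y₁ → ∑ X₂ (λ x₂ → ∑ Y₂ (g x₁ y₁ x₂)))) ∎
    where
    ∑ : ℕ → (ℕ → Carrier) → Carrier
    ∑ n = fold (divisors n)

  fold-divisors-p^k : ∀ {p} k → Prime p → ∀ f →
    fold (divisors (p ℕ.^ k)) f ≈ fold (upTo (suc k)) (λ i → f (p ℕ.^ i))
  fold-divisors-p^k {p} k pp f = begin
    fold (divisors (p ℕ.^ k)) f  ≈⟨ fold-∈⇔ f (unique-divisors (p ℕ.^ k)) unique-powers (mk⇔ to from) ⟩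
    fold powers f                ≈⟨ fold-map (p ℕ.^_) (upTo (suc k)) f ⟩
    fold (upTo (suc k)) (λ i → f (p ℕ.^ i)) ∎
    where
    powers = map (p ℕ.^_) (upTo (suc k))
    unique-powers : Unique powers
    unique-powers = Unique.map⁺ (^-injectiveʳ (prime>1 pp)) (Unique.upTo⁺ (suc k))
    to : ∀ {d} → d ∈ divisors (p ℕ.^ k) → d ∈ powers
    to d∈ with ∣p^k⇒≡p^i pp k (proj₁ (∈-divisors⁻ (p ℕ.^ k) d∈))
    ... | i , i≤k , ≡.refl = ∈-map⁺ (p ℕ.^_) (∈-upTo⁺ (s≤s i≤k))
    from : ∀ {d} → d ∈ powers → d ∈ divisors (p ℕ.^ k)
    from d∈ with ∈-map⁻ (p ℕ.^_) d∈
    ... | i , i∈ , ≡.refl = ∈-divisors⁺ (p^k>0 k pp) (p^i∣p^k (ℕₚ.≤-pred (∈-upTo⁻ i∈)))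

  fold-primeDivisors-coprime-* : ∀ {m n} → Coprime m n → 0 < m → 0 < n → ∀ f →
    fold (primeDivisors (m ℕ.* n)) f ≈ fold (primeDivisors m) f ∙ fold (primeDivisors n) f
  fold-primeDivisors-coprime-* {m} {n} m⊥n 0<m 0<n f = begin
    fold (primeDivisors (m ℕ.* n)) f ≈⟨ fold-∈⇔ f (unique-primeDivisors (m ℕ.* n)) unique-both (mk⇔ to from) ⟩
    fold both f                      ≈⟨ fold-++ (primeDivisors m) (primeDivisors n) f ⟩
    fold (primeDivisors m) f ∙ fold (primeDivisors n) f ∎
    where
    both = primeDivisors m ++ primeDivisors n
    unique-both : Unique both
    unique-both = Unique.++⁺ (unique-primeDivisors m) (unique-primeDivisors n) λ (q∈m , q∈n) →
      let (pq , q∣m) = ∈-primeDivisors⁻ m q∈m ; (_ , q∣n) = ∈-primeDivisors⁻ n q∈n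
      in ¬prime[1] (≡.subst Prime (m⊥n (q∣m , q∣n)) pq)
    to : ∀ {q} → q ∈ primeDivisors (m ℕ.* n) → q ∈ both
    to q∈ with ∈-primeDivisors⁻ (m ℕ.* n) q∈
    ... | pq , q∣mn with euclidsLemma m n pq q∣mn
    ... | inj₁ q∣m = ∈-++⁺ˡ (∈-primeDivisors⁺ 0<m pq q∣m)
    ... | inj₂ q∣n = ∈-++⁺ʳ (primeDivisors m) (∈-primeDivisors⁺ 0<n pq q∣n)
    from : ∀ {q} → q ∈ both → q ∈ primeDivisors (m ℕ.* n)
    from q∈ with ∈-++⁻ (primeDivisors m) q∈
    ... | inj₁ q∈m = let (pq , q∣m) = ∈-primeDivisors⁻ m q∈m in ∈-primeDivisors⁺ (m*n>0 0<m 0<n) pq (∣m⇒∣m*n n q∣m)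
    ... | inj₂ q∈n = let (pq , q∣n) = ∈-primeDivisors⁻ n q∈n in ∈-primeDivisors⁺ (m*n>0 0<m 0<n) pq (∣n⇒∣m*n m q∣n)

  fold-primeDivisors-p^k : ∀ {p} k → Prime p → ∀ f → fold (primeDivisors (p ℕ.^ suc k)) f ≈ f p
  fold-primeDivisors-p^k {p} k pp f =
    trans (fold-∈⇔ f (unique-primeDivisors (p ℕ.^ suc k)) ([] ∷ []) (mk⇔ to from)) (identityʳ (f p))
    where
    to : ∀ {q} → q ∈ primeDivisors (p ℕ.^ suc k) → q ∈ p ∷ []
    to q∈ = let (pq , q∣p^k) = ∈-primeDivisors⁻ (p ℕ.^ suc k) q∈ in here (prime∣p^k⇒≡p (suc k) pp pq q∣p^k)
    from : ∀ {q} → q ∈ p ∷ [] → q ∈ primeDivisors (p ℕ.^ suc k)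
    from (here ≡.refl) = ∈-primeDivisors⁺ (p^k>0 (suc k) pp) pp (m∣m*n (p ℕ.^ k))

module RingSum {c ℓ} (R : CommutativeRing c ℓ) where
  open Arith R
  module Sum = DivisorFold +-commutativeMonoid
  module Product = DivisorFold *-commutativeMonoid

  *-distribˡ-sum : ∀ (xs : List ℕ) a f → a * sumOver xs f ≈ sumOver xs (λ x → a * f x)
  *-distribˡ-sum [] a f = zeroʳ a
  *-distribˡ-sum (x ∷ xs) a f = trans (distribˡ _ _ _) (+-congˡ (*-distribˡ-sum xs a f))

  *-distribˡ-sum² : ∀ (xs ys : List ℕ) a (f : ℕ → ℕ → Carrier) →
    a * sumOver xs (λ x → sumOver ys (f x)) ≈ sumOver xs (λ x → sumOver ys (λ y → a * f x y))
  *-distribˡ-sum² xs ys a f =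
    trans (*-distribˡ-sum xs a _) (Sum.fold-cong xs (λ _ → *-distribˡ-sum ys a _))

  sum-upTo-suc : ∀ n f → sumOver (upTo (suc n)) f ≈ f 0 + sumOver (upTo n) (f ∘ suc)
  sum-upTo-suc n f = +-congˡ (trans (reflexive (≡.cong (λ xs → sumOver xs f) (≡.sym (map-upTo suc n))))
                                    (Sum.fold-map suc (upTo n) f))

  sum-upTo-2+ : ∀ n f → (∀ j → f (2 ℕ.+ j) ≈ 0#) → sumOver (upTo (2 ℕ.+ n)) f ≈ f 0 + f 1
  sum-upTo-2+ n f f≈0 = trans (sum-upTo-suc (suc n) f) (+-congˡ (trans (sum-upTo-suc n (f ∘ suc))
    (trans (+-congˡ (trans (Sum.fold-cong (upTo n) (λ {j} _ → f≈0 j)) (Sum.fold-ε (upTo n)))) (+-identityʳ _))))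

  +-cancel-zero : ∀ {w z s} → z ≈ 0# → w + z * s ≈ w
  +-cancel-zero z≈0 = trans (+-congˡ (trans (*-congʳ z≈0) (zeroˡ _))) (+-identityʳ _)

  indicator : ∀ {p} {P : Set p} → Dec P → Carrier
  indicator (yes _) = 1#
  indicator (no _) = 0#

  indicator-× : ∀ {p q r} {P : Set p} {Q : Set q} {Q′ : Set r} (P? : Dec P) (Q? : Dec Q) (Q′? : Dec Q′) →
    P ⇔ (Q × Q′) → indicator P? ≈ indicator Q? * indicator Q′?
  indicator-× (yes _) (yes _) (yes _) _ = sym (*-identityˡ 1#)
  indicator-× (yes P) (no ¬Q) _ P⇔QQ′ = ⊥-elim (¬Q (proj₁ (Equivalence.to P⇔QQ′ P)))
  indicator-× (yes P) (yes _) (no ¬Q′) P⇔QQ′ = ⊥-elim (¬Q′ (proj₂ (Equivalence.to P⇔QQ′ P)))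
  indicator-× (no ¬P) (yes Q) (yes Q′) P⇔QQ′ = ⊥-elim (¬P (Equivalence.from P⇔QQ′ (Q , Q′)))
  indicator-× (no _) (no _) _ _ = sym (zeroˡ _)
  indicator-× (no _) (yes _) (no _) _ = sym (zeroʳ _)

  indicator-yes : ∀ {p} {P : Set p} (P? : Dec P) → P → indicator P? ≈ 1#
  indicator-yes (yes _) _ = refl
  indicator-yes (no ¬P) P = ⊥-elim (¬P P)

  indicator-no : ∀ {p} {P : Set p} (P? : Dec P) → ¬ P → indicator P? ≈ 0#
  indicator-no (yes P) ¬P = ⊥-elim (¬P P)
  indicator-no (no _) _ = refl

  sum-filter : ∀ {p} {P : Pred ℕ p} (P? : Decidable P) xs f →
    sumOver (filter P? xs) f ≈ sumOver xs (λ x → indicator (P? x) * f x)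
  sum-filter P? [] f = refl
  sum-filter P? (x ∷ xs) f with P? x
  ... | yes _ = +-cong (sym (*-identityˡ _)) (sum-filter P? xs f)
  ... | no _  = trans (sum-filter P? xs f) (sym (trans (+-congʳ (zeroˡ _)) (+-identityˡ _)))

module Multiplicative {c ℓ} (R : CommutativeRing c ℓ) where
  open Arith R
  open RingSum R
  open import Algebra.Properties.Ring ring using (-1*x≈-x)
  open import Relation.Binary.Reasoning.Setoid setoid

  ω-* : ∀ ω → CompletelyMultiplicative ω → ∀ {m n} → 0 < m → 0 < n → ω (m ℕ.* n) ≈ ω m * ω n
  ω-* ω (_ , ω-*′) {suc m} {suc n} _ _ = ω-*′ m n

  signPow-length : ∀ (xs : List ℕ) → signPow (Data.List.length xs) ≈ prodOver xs (λ _ → - 1#)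
  signPow-length [] = refl
  signPow-length (x ∷ xs) = trans (-‿cong (signPow-length xs)) (sym (-1*x≈-x _))

  μ-squarefree : ∀ n → SquareFree n → μ n ≈ prodOver (primeDivisors n) (λ _ → - 1#)
  μ-squarefree n sf with squarefree n | Equivalence.from (squarefree⇔SquareFree n) sf
  ... | true | _ = signPow-length (primeDivisors n)

  μ-¬squarefree : ∀ n → ¬ SquareFree n → μ n ≈ 0#
  μ-¬squarefree n ¬sf with squarefree n | Equivalence.to (squarefree⇔SquareFree n)
  ... | true  | sf = ⊥-elim (¬sf (sf _))
  ... | false | _  = refl

  μ-coprime-* : ∀ {m n} → Coprime m n → 0 < m → 0 < n → μ (m ℕ.* n) ≈ μ m * μ n
  μ-coprime-* {m} {n} m⊥n 0<m 0<n with SquareFree? m | SquareFree? n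
  ... | yes sfm | yes sfn = begin
    μ (m ℕ.* n)
      ≈⟨ μ-squarefree (m ℕ.* n) (Equivalence.from sf* (sfm , sfn)) ⟩
    prodOver (primeDivisors (m ℕ.* n)) (λ _ → - 1#)
      ≈⟨ Product.fold-primeDivisors-coprime-* m⊥n 0<m 0<n _ ⟩
    prodOver (primeDivisors m) (λ _ → - 1#) * prodOver (primeDivisors n) (λ _ → - 1#)
      ≈⟨ *-cong (μ-squarefree m sfm) (μ-squarefree n sfn) ⟨
    μ m * μ n ∎
    where sf* = SquareFree-coprime-* m⊥n 0<m 0<n
  ... | no ¬sfm | _ = trans (μ-¬squarefree (m ℕ.* n) (¬sfm ∘ proj₁ ∘ Equivalence.to sf*))
                       (sym (trans (*-congʳ (μ-¬squarefree m ¬sfm)) (zeroˡ _)))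
    where sf* = SquareFree-coprime-* m⊥n 0<m 0<n
  ... | _ | no ¬sfn = trans (μ-¬squarefree (m ℕ.* n) (¬sfn ∘ proj₂ ∘ Equivalence.to sf*))
                       (sym (trans (*-congˡ (μ-¬squarefree n ¬sfn)) (zeroʳ _)))
    where sf* = SquareFree-coprime-* m⊥n 0<m 0<n

  μ-p : ∀ {p} → Prime p → μ (p ℕ.^ 1) ≈ - 1#
  μ-p {p} pp = trans (μ-squarefree (p ℕ.^ 1) (SquareFree-p^1 pp))
                     (Product.fold-primeDivisors-p^k 0 pp (λ _ → - 1#))

  μ-p^[2+k] : ∀ {p} k → Prime p → μ (p ℕ.^ (2 ℕ.+ k)) ≈ 0#
  μ-p^[2+k] k pp = μ-¬squarefree _ (¬SquareFree-p^[2+k] k pp)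

-- The inversion formula

module Inversion {c ℓ} (R : CommutativeRing c ℓ) (ω₁ ω₂ : ℕ → CommutativeRing.Carrier R)
  (ω₁-cm : Arith.CompletelyMultiplicative R ω₁) (ω₂-cm : Arith.CompletelyMultiplicative R ω₂) where
  open Arith R
  open RingSum R
  open Multiplicative R
  open import Algebra.Properties.CommutativeSemigroup *-commutativeSemigroup using (x∙yz≈y∙xz; xy∙z≈y∙xz; interchange)
  open import Algebra.Properties.Ring ring using (-1*x≈-x; -‿involutive; -‿distribˡ-*; -‿distribʳ-*)
  open import Algebra.Solver.Ring.NaturalCoefficients.Default commutativeSemiring using (solve; _:+_; _:*_; _:=_; con)
  open import Relation.Binary.Reasoning.Setoid setoid

  J′ : ℕ → (ℕ → Carrier) → ℕ → Carrier
  J′ L = J L ω₁ ω₂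

  coeff : ℕ → ℕ → Carrier
  coeff a b = μ a * μ b * ω₂ a * ω₁ b

  coeff-coprime-* : ∀ {a₁ a₂ b₁ b₂} → Coprime a₁ a₂ → Coprime b₁ b₂ → 0 < a₁ → 0 < a₂ → 0 < b₁ → 0 < b₂ →
    coeff (a₁ ℕ.* a₂) (b₁ ℕ.* b₂) ≈ coeff a₁ b₁ * coeff a₂ b₂
  coeff-coprime-* {a₁} {a₂} {b₁} {b₂} a₁⊥a₂ b₁⊥b₂ 0<a₁ 0<a₂ 0<b₁ 0<b₂ = begin
    μ (a₁ ℕ.* a₂) * μ (b₁ ℕ.* b₂) * ω₂ (a₁ ℕ.* a₂) * ω₁ (b₁ ℕ.* b₂)
      ≈⟨ *-cong (*-cong (*-cong (μ-coprime-* a₁⊥a₂ 0<a₁ 0<a₂) (μ-coprime-* b₁⊥b₂ 0<b₁ 0<b₂))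
                        (ω-* ω₂ ω₂-cm 0<a₁ 0<a₂)) (ω-* ω₁ ω₁-cm 0<b₁ 0<b₂) ⟩
    (μ a₁ * μ a₂) * (μ b₁ * μ b₂) * (ω₂ a₁ * ω₂ a₂) * (ω₁ b₁ * ω₁ b₂)
      ≈⟨ *-cong (*-congʳ (interchange _ _ _ _)) refl ⟩
    (μ a₁ * μ b₁) * (μ a₂ * μ b₂) * (ω₂ a₁ * ω₂ a₂) * (ω₁ b₁ * ω₁ b₂)
      ≈⟨ *-congʳ (interchange _ _ _ _) ⟩
    (μ a₁ * μ b₁ * ω₂ a₁) * (μ a₂ * μ b₂ * ω₂ a₂) * (ω₁ b₁ * ω₁ b₂)
      ≈⟨ interchange _ _ _ _ ⟩
    coeff a₁ b₁ * coeff a₂ b₂ ∎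

  coeff-1-1 : coeff 1 1 ≈ 1#
  coeff-1-1 = trans (*-cong (*-congˡ (proj₁ ω₂-cm)) (proj₁ ω₁-cm))
                    (trans (*-identityʳ _) (trans (*-identityʳ _) (*-identityʳ _)))

  J-cong : ∀ L g {K K′} → (∀ u → K u ≈ K′ u) → J′ L K g ≈ J′ L K′ g
  J-cong L g K≈K′ = Sum.fold-cong (divisors g) (λ _ → Sum.fold-cong (divisors (L div g)) (λ _ → *-congˡ (K≈K′ _)))

  J-*ˡ : ∀ L g a K → J′ L (λ u → a * K u) g ≈ a * J′ L K g
  J-*ˡ L g a K = trans
    (Sum.fold-cong (divisors g) (λ _ → Sum.fold-cong (divisors (L div g)) (λ _ → x∙yz≈y∙xz _ a _)))
    (sym (*-distribˡ-sum² (divisors g) (divisors (L div g)) a _))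

  J-sum : ∀ L g (xs : List ℕ) (H : ℕ → ℕ → Carrier) →
    J′ L (λ u → sumOver xs (λ x → H x u)) g ≈ sumOver xs (λ x → J′ L (H x) g)
  J-sum L g xs H = begin
    Σ∣ g (λ a → Σ∣ (L div g) (λ b → coeff a b * sumOver xs (λ x → H x (arg a b))))
      ≈⟨ Sum.fold-cong (divisors g) (λ _ → Sum.fold-cong (divisors (L div g)) (λ _ → *-distribˡ-sum xs _ _)) ⟩
    Σ∣ g (λ a → Σ∣ (L div g) (λ b → sumOver xs (λ x → coeff a b * H x (arg a b))))
      ≈⟨ Sum.fold-cong (divisors g) (λ _ → Sum.fold-comm (divisors (L div g)) xs _) ⟩
    Σ∣ g (λ a → sumOver xs (λ x → Σ∣ (L div g) (λ b → coeff a b * H x (arg a b))))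
      ≈⟨ Sum.fold-comm (divisors g) xs _ ⟩
    sumOver xs (λ x → J′ L (H x) g) ∎
    where
    arg : ℕ → ℕ → ℕ
    arg a b = (b ℕ.* g) div a

  J-coprime-* : ∀ {L₁ L₂ g₁ g₂} → Coprime L₁ L₂ → 0 < L₁ → 0 < L₂ → g₁ ∣ L₁ → g₂ ∣ L₂ → ∀ K →
    J′ (L₁ ℕ.* L₂) K (g₁ ℕ.* g₂) ≈ J′ L₁ (λ u → J′ L₂ (λ v → K (u ℕ.* v)) g₂) g₁
  J-coprime-* {L₁} {L₂} {g₁} {g₂} L₁⊥L₂ 0<L₁ 0<L₂ g₁∣L₁ g₂∣L₂ K = begin
    Σ∣ (g₁ ℕ.* g₂) (λ a → Σ∣ ((L₁ ℕ.* L₂) div (g₁ ℕ.* g₂)) (λ b → term a b))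
      ≡⟨ ≡.cong (λ h → Σ∣ (g₁ ℕ.* g₂) (λ a → Σ∣ h (λ b → term a b))) (div-*-interchange 0<g₁ 0<g₂ g₁∣L₁ g₂∣L₂) ⟩
    Σ∣ (g₁ ℕ.* g₂) (λ a → Σ∣ (h₁ ℕ.* h₂) (λ b → term a b))
      ≈⟨ Sum.fold-divisors²-coprime-* (coprime-∣-∣ L₁⊥L₂ g₁∣L₁ g₂∣L₂) (coprime-∣-∣ L₁⊥L₂ h₁∣L₁ h₂∣L₂)
           0<g₁ 0<g₂ 0<h₁ 0<h₂ term _ term-split ⟩
    Σ∣ g₁ (λ a₁ → Σ∣ h₁ (λ b₁ → Σ∣ g₂ (λ a₂ → Σ∣ h₂ (λ b₂ →
      coeff a₁ b₁ * (coeff a₂ b₂ * K (((b₁ ℕ.* g₁) div a₁) ℕ.* ((b₂ ℕ.* g₂) div a₂)))))))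
      ≈⟨ Sum.fold-cong (divisors g₁) (λ _ → Sum.fold-cong (divisors h₁) (λ _ →
           sym (*-distribˡ-sum² (divisors g₂) (divisors h₂) _ _))) ⟩
    J′ L₁ (λ u → J′ L₂ (λ v → K (u ℕ.* v)) g₂) g₁ ∎
    where
    h₁ = L₁ div g₁
    h₂ = L₂ div g₂
    0<g₁ = ∣-pos 0<L₁ g₁∣L₁
    0<g₂ = ∣-pos 0<L₂ g₂∣L₂
    h₁∣L₁ = n-div-m∣n 0<g₁ g₁∣L₁
    h₂∣L₂ = n-div-m∣n 0<g₂ g₂∣L₂
    0<h₁ = ∣-pos 0<L₁ h₁∣L₁
    0<h₂ = ∣-pos 0<L₂ h₂∣L₂
    term : ℕ → ℕ → Carrier
    term a b = coeff a b * K ((b ℕ.* (g₁ ℕ.* g₂)) div a)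
    term-split : ∀ {a₁ a₂ b₁ b₂} → a₁ ∣ g₁ → a₂ ∣ g₂ → b₁ ∣ h₁ → b₂ ∣ h₂ →
      term (a₁ ℕ.* a₂) (b₁ ℕ.* b₂) ≈ coeff a₁ b₁ * (coeff a₂ b₂ * K (((b₁ ℕ.* g₁) div a₁) ℕ.* ((b₂ ℕ.* g₂) div a₂)))
    term-split {a₁} {a₂} {b₁} {b₂} a₁∣g₁ a₂∣g₂ b₁∣h₁ b₂∣h₂ = trans
      (*-cong (coeff-coprime-* (coprime-∣-∣ L₁⊥L₂ (∣-trans a₁∣g₁ g₁∣L₁) (∣-trans a₂∣g₂ g₂∣L₂))
                               (coprime-∣-∣ L₁⊥L₂ (∣-trans b₁∣h₁ h₁∣L₁) (∣-trans b₂∣h₂ h₂∣L₂))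
                               (∣-pos 0<g₁ a₁∣g₁) (∣-pos 0<g₂ a₂∣g₂) (∣-pos 0<h₁ b₁∣h₁) (∣-pos 0<h₂ b₂∣h₂))
              (reflexive (≡.cong K (div-*-interchange² {y₁ = b₁} {b₂} (∣-pos 0<g₁ a₁∣g₁) (∣-pos 0<g₂ a₂∣g₂)
                                      (∣n⇒∣m*n b₁ a₁∣g₁) (∣n⇒∣m*n b₂ a₂∣g₂)))))
      (*-assoc _ _ _)

  weight : ℕ → ℕ → Carrier
  weight d e = indicator (gcd d e ℕ.≟ 1) * (ω₁ d * ω₂ e)

  weight-coprime-* : ∀ {L₁ L₂ d₁ d₂ e₁ e₂} → Coprime L₁ L₂ → d₁ ∣ L₁ → e₁ ∣ L₁ → d₂ ∣ L₂ → e₂ ∣ L₂ →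
    0 < d₁ → 0 < d₂ → 0 < e₁ → 0 < e₂ → weight (d₁ ℕ.* d₂) (e₁ ℕ.* e₂) ≈ weight d₁ e₁ * weight d₂ e₂
  weight-coprime-* {d₁ = d₁} {d₂} {e₁} {e₂} L₁⊥L₂ d₁∣L₁ e₁∣L₁ d₂∣L₂ e₂∣L₂ 0<d₁ 0<d₂ 0<e₁ 0<e₂ = begin
    indicator (gcd (d₁ ℕ.* d₂) (e₁ ℕ.* e₂) ℕ.≟ 1) * (ω₁ (d₁ ℕ.* d₂) * ω₂ (e₁ ℕ.* e₂))
      ≈⟨ *-cong (indicator-× (gcd (d₁ ℕ.* d₂) (e₁ ℕ.* e₂) ℕ.≟ 1) (gcd d₁ e₁ ℕ.≟ 1) (gcd d₂ e₂ ℕ.≟ 1)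
                  (gcd-*-≡1⇔ L₁⊥L₂ d₁∣L₁ e₁∣L₁ d₂∣L₂ e₂∣L₂))
                (*-cong (ω-* ω₁ ω₁-cm 0<d₁ 0<d₂) (ω-* ω₂ ω₂-cm 0<e₁ 0<e₂)) ⟩
    (indicator (gcd d₁ e₁ ℕ.≟ 1) * indicator (gcd d₂ e₂ ℕ.≟ 1)) * ((ω₁ d₁ * ω₁ d₂) * (ω₂ e₁ * ω₂ e₂))
      ≈⟨ *-congˡ (interchange _ _ _ _) ⟩
    (indicator (gcd d₁ e₁ ℕ.≟ 1) * indicator (gcd d₂ e₂ ℕ.≟ 1)) * ((ω₁ d₁ * ω₂ e₁) * (ω₁ d₂ * ω₂ e₂))
      ≈⟨ interchange _ _ _ _ ⟩
    weight d₁ e₁ * weight d₂ e₂ ∎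

  weight-1-e : ∀ e → weight 1 e ≈ ω₂ e
  weight-1-e e = trans (*-cong (indicator-yes (gcd 1 e ℕ.≟ 1) (gcd-zeroˡ e)) (*-congʳ (proj₁ ω₁-cm)))
                       (trans (*-identityˡ _) (*-identityˡ _))

  weight-d-1 : ∀ d → weight d 1 ≈ ω₁ d
  weight-d-1 d = trans (*-cong (indicator-yes (gcd d 1 ℕ.≟ 1) (gcd-zeroʳ d)) (*-congˡ (proj₁ ω₂-cm)))
                       (trans (*-identityˡ _) (*-identityʳ _))

  -- The right-hand sum of the theorem, with the condition (d, e) = 1 carried by the indicator in weight.
  JSum : ℕ → ℕ → ℕ → (ℕ → Carrier) → Carrier
  JSum L A B K = Σ∣ A (λ d → Σ∣ B (λ e → weight d e * J′ L K ((B ℕ.* d) div e)))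

  JSum-cong : ∀ L A B {K K′} → (∀ u → K u ≈ K′ u) → JSum L A B K ≈ JSum L A B K′
  JSum-cong L A B K≈K′ = Sum.fold-cong (divisors A) (λ {d} _ → Sum.fold-cong (divisors B) (λ {e} _ →
    *-congˡ (J-cong L ((B ℕ.* d) div e) K≈K′)))

  JSum-*ˡ : ∀ L A B a K → JSum L A B (λ u → a * K u) ≈ a * JSum L A B K
  JSum-*ˡ L A B a K = trans
    (Sum.fold-cong (divisors A) (λ {d} _ → Sum.fold-cong (divisors B) (λ {e} _ →
      trans (*-congˡ (J-*ˡ L ((B ℕ.* d) div e) a K)) (x∙yz≈y∙xz _ a _))))
    (sym (*-distribˡ-sum² (divisors A) (divisors B) a _))

  J-linear : ∀ L g (xs ys : List ℕ) (w : ℕ → ℕ → Carrier) (H : ℕ → ℕ → ℕ → Carrier) →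
    J′ L (λ u → sumOver xs (λ x → sumOver ys (λ y → w x y * H x y u))) g ≈
    sumOver xs (λ x → sumOver ys (λ y → w x y * J′ L (H x y) g))
  J-linear L g xs ys w H = begin
    J′ L (λ u → sumOver xs (λ x → sumOver ys (λ y → w x y * H x y u))) g
      ≈⟨ J-sum L g xs (λ x u → sumOver ys (λ y → w x y * H x y u)) ⟩
    sumOver xs (λ x → J′ L (λ u → sumOver ys (λ y → w x y * H x y u)) g)
      ≈⟨ Sum.fold-cong xs (λ {x} _ → J-sum L g ys (λ y u → w x y * H x y u)) ⟩
    sumOver xs (λ x → sumOver ys (λ y → J′ L (λ u → w x y * H x y u) g))
      ≈⟨ Sum.fold-cong xs (λ {x} _ → Sum.fold-cong ys (λ {y} _ → J-*ˡ L g (w x y) (H x y))) ⟩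
    sumOver xs (λ x → sumOver ys (λ y → w x y * J′ L (H x y) g)) ∎

  JSum-coprime-* : ∀ {L₁ L₂ A₁ A₂ B₁ B₂} → Coprime L₁ L₂ → 0 < L₁ → 0 < L₂ →
    A₁ ℕ.* B₁ ≡ L₁ → A₂ ℕ.* B₂ ≡ L₂ → ∀ K →
    JSum (L₁ ℕ.* L₂) (A₁ ℕ.* A₂) (B₁ ℕ.* B₂) K ≈ JSum L₁ A₁ B₁ (λ u → JSum L₂ A₂ B₂ (λ v → K (u ℕ.* v)))
  JSum-coprime-* {L₁} {L₂} {A₁} {A₂} {B₁} {B₂} L₁⊥L₂ 0<L₁ 0<L₂ ≡.refl ≡.refl K = begin
    Σ∣ (A₁ ℕ.* A₂) (λ d → Σ∣ (B₁ ℕ.* B₂) (term d))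
      ≈⟨ Sum.fold-divisors²-coprime-* (coprime-∣-∣ L₁⊥L₂ A₁∣L₁ A₂∣L₂) (coprime-∣-∣ L₁⊥L₂ B₁∣L₁ B₂∣L₂)
           0<A₁ 0<A₂ 0<B₁ 0<B₂ term _ term-split ⟩
    Σ∣ A₁ (λ d₁ → Σ∣ B₁ (λ e₁ → Σ∣ A₂ (λ d₂ → Σ∣ B₂ (λ e₂ →
      weight d₁ e₁ * (weight d₂ e₂ * J′ L₁ (Φ (g₂ d₂ e₂)) (g₁ d₁ e₁))))))
      ≈⟨ Sum.fold-cong (divisors A₁) (λ {d₁} _ → Sum.fold-cong (divisors B₁) (λ {e₁} _ →
           trans (sym (*-distribˡ-sum² (divisors A₂) (divisors B₂) (weight d₁ e₁) _))
                 (*-congˡ (sym (J-linear L₁ (g₁ d₁ e₁) (divisors A₂) (divisors B₂) weight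
                                         (λ d₂ e₂ → Φ (g₂ d₂ e₂))))))) ⟩
    JSum L₁ A₁ B₁ (λ u → JSum L₂ A₂ B₂ (λ v → K (u ℕ.* v))) ∎
    where
    A₁∣L₁ = m∣m*n B₁
    A₂∣L₂ = m∣m*n B₂
    B₁∣L₁ = n∣m*n A₁
    B₂∣L₂ = n∣m*n A₂
    0<A₁ = ∣-pos 0<L₁ A₁∣L₁
    0<A₂ = ∣-pos 0<L₂ A₂∣L₂
    0<B₁ = ∣-pos 0<L₁ B₁∣L₁
    0<B₂ = ∣-pos 0<L₂ B₂∣L₂
    g₁ g₂ : ℕ → ℕ → ℕ
    g₁ d₁ e₁ = (B₁ ℕ.* d₁) div e₁
    g₂ d₂ e₂ = (B₂ ℕ.* d₂) div e₂
    Φ : ℕ → ℕ → Carrier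
    Φ g u = J′ L₂ (λ v → K (u ℕ.* v)) g
    term : ℕ → ℕ → Carrier
    term d e = weight d e * J′ (L₁ ℕ.* L₂) K (((B₁ ℕ.* B₂) ℕ.* d) div e)
    term-split : ∀ {d₁ d₂ e₁ e₂} → d₁ ∣ A₁ → d₂ ∣ A₂ → e₁ ∣ B₁ → e₂ ∣ B₂ →
      term (d₁ ℕ.* d₂) (e₁ ℕ.* e₂) ≈ weight d₁ e₁ * (weight d₂ e₂ * J′ L₁ (Φ (g₂ d₂ e₂)) (g₁ d₁ e₁))
    term-split {d₁} {d₂} {e₁} {e₂} d₁∣A₁ d₂∣A₂ e₁∣B₁ e₂∣B₂ = begin
      weight (d₁ ℕ.* d₂) (e₁ ℕ.* e₂) * J′ (L₁ ℕ.* L₂) K (((B₁ ℕ.* B₂) ℕ.* (d₁ ℕ.* d₂)) div (e₁ ℕ.* e₂))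
        ≈⟨ *-cong (weight-coprime-* L₁⊥L₂ (∣-trans d₁∣A₁ A₁∣L₁) (∣-trans e₁∣B₁ B₁∣L₁) (∣-trans d₂∣A₂ A₂∣L₂)
                    (∣-trans e₂∣B₂ B₂∣L₂) (∣-pos 0<A₁ d₁∣A₁) (∣-pos 0<A₂ d₂∣A₂) 0<e₁ 0<e₂)
                  (reflexive (≡.cong (J′ (L₁ ℕ.* L₂) K)
                    (div-*-interchange² {y₁ = B₁} {B₂} 0<e₁ 0<e₂ (∣m⇒∣m*n d₁ e₁∣B₁) (∣m⇒∣m*n d₂ e₂∣B₂)))) ⟩
      (weight d₁ e₁ * weight d₂ e₂) * J′ (L₁ ℕ.* L₂) K (g₁ d₁ e₁ ℕ.* g₂ d₂ e₂)
        ≈⟨ *-congˡ (J-coprime-* L₁⊥L₂ 0<L₁ 0<L₂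
                      ([n*d]-div-e∣m*n 0<e₁ e₁∣B₁ d₁∣A₁) ([n*d]-div-e∣m*n 0<e₂ e₂∣B₂ d₂∣A₂) K) ⟩
      (weight d₁ e₁ * weight d₂ e₂) * J′ L₁ (Φ (g₂ d₂ e₂)) (g₁ d₁ e₁)
        ≈⟨ *-assoc _ _ _ ⟩
      weight d₁ e₁ * (weight d₂ e₂ * J′ L₁ (Φ (g₂ d₂ e₂)) (g₁ d₁ e₁)) ∎
      where
      0<e₁ = ∣-pos 0<B₁ e₁∣B₁
      0<e₂ = ∣-pos 0<B₂ e₂∣B₂

  eulerFactor : ℕ → Carrier
  eulerFactor L = prodOver (primeDivisors L) (λ p → 1# - ω₁ p * ω₂ p)

  InversionAt : ℕ → Set (c ⊔ ℓ)
  InversionAt L = ∀ K A B → A ℕ.* B ≡ L → eulerFactor L * K B ≈ JSum L A B K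

  inversion-coprime-* : ∀ {L₁ L₂} → Coprime L₁ L₂ → 0 < L₁ → 0 < L₂ →
    InversionAt L₁ → InversionAt L₂ → InversionAt (L₁ ℕ.* L₂)
  inversion-coprime-* {L₁} {L₂} L₁⊥L₂ 0<L₁ 0<L₂ inv₁ inv₂ K A B AB≡L
    with coprime-∣*-split L₁⊥L₂ 0<L₁ (divides B (≡.trans (≡.sym AB≡L) (ℕₚ.*-comm A B)))
  ... | A₁ , A₂ , A₁∣L₁ , A₂∣L₂ , ≡.refl
    with ≡.refl ← [a*b]*c≡m*n⇒c≡[m-div-a]*[n-div-b] (∣-pos 0<L₁ A₁∣L₁) (∣-pos 0<L₂ A₂∣L₂) A₁∣L₁ A₂∣L₂ AB≡L = begin
    eulerFactor (L₁ ℕ.* L₂) * K (B₁ ℕ.* B₂)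
      ≈⟨ *-congʳ (Product.fold-primeDivisors-coprime-* L₁⊥L₂ 0<L₁ 0<L₂ _) ⟩
    (eulerFactor L₁ * eulerFactor L₂) * K (B₁ ℕ.* B₂)
      ≈⟨ xy∙z≈y∙xz _ _ _ ⟩
    eulerFactor L₂ * (eulerFactor L₁ * K (B₁ ℕ.* B₂))
      ≈⟨ *-congˡ (inv₁ (λ u → K (u ℕ.* B₂)) A₁ B₁ A₁B₁≡L₁) ⟩
    eulerFactor L₂ * JSum L₁ A₁ B₁ (λ u → K (u ℕ.* B₂))
      ≈⟨ JSum-*ˡ L₁ A₁ B₁ (eulerFactor L₂) (λ u → K (u ℕ.* B₂)) ⟨
    JSum L₁ A₁ B₁ (λ u → eulerFactor L₂ * K (u ℕ.* B₂))
      ≈⟨ JSum-cong L₁ A₁ B₁ (λ u → inv₂ (λ v → K (u ℕ.* v)) A₂ B₂ A₂B₂≡L₂) ⟩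
    JSum L₁ A₁ B₁ (λ u → JSum L₂ A₂ B₂ (λ v → K (u ℕ.* v)))
      ≈⟨ JSum-coprime-* {A₁ = A₁} {A₂} {B₁} {B₂} L₁⊥L₂ 0<L₁ 0<L₂ A₁B₁≡L₁ A₂B₂≡L₂ K ⟨
    JSum (L₁ ℕ.* L₂) (A₁ ℕ.* A₂) (B₁ ℕ.* B₂) K ∎
    where
    B₁ = L₁ div A₁
    B₂ = L₂ div A₂
    A₁B₁≡L₁ = m*[n-div-m]≡n (∣-pos 0<L₁ A₁∣L₁) A₁∣L₁
    A₂B₂≡L₂ = m*[n-div-m]≡n (∣-pos 0<L₂ A₂∣L₂) A₂∣L₂

  module PrimePower {p} (pp : Prime p) (K : ℕ → Carrier) where
    x y : Carrier
    x = ω₁ p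
    y = ω₂ p

    ω-p : ∀ (ω : ℕ → Carrier) → ω (p ℕ.^ 1) ≈ ω p
    ω-p ω = reflexive (≡.cong ω (ℕₚ.*-identityʳ p))

    ω-p^suc : ∀ ω → CompletelyMultiplicative ω → ∀ k → ω (p ℕ.^ suc k) ≈ ω p * ω (p ℕ.^ k)
    ω-p^suc ω cm k = ω-* ω cm (prime>0 pp) (p^k>0 k pp)

    coeff-1-p : coeff 1 (p ℕ.^ 1) ≈ - x
    coeff-1-p = trans (*-cong (*-cong (*-congˡ (μ-p pp)) (proj₁ ω₂-cm)) (ω-p ω₁))
                      (trans (*-congʳ (trans (*-identityʳ _) (*-identityˡ _))) (-1*x≈-x x))

    coeff-p-1 : coeff (p ℕ.^ 1) 1 ≈ - y
    coeff-p-1 = trans (*-cong (*-cong (*-congʳ (μ-p pp)) (ω-p ω₂)) (proj₁ ω₁-cm))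
                      (trans (*-identityʳ _) (trans (*-congʳ (*-identityʳ _)) (-1*x≈-x y)))

    coeff-p-p : coeff (p ℕ.^ 1) (p ℕ.^ 1) ≈ x * y
    coeff-p-p = trans (*-cong (*-cong (*-cong (μ-p pp) (μ-p pp)) (ω-p ω₂)) (ω-p ω₁))
                      (trans (*-congʳ (trans (*-congʳ (trans (-1*x≈-x (- 1#)) (-‿involutive 1#))) (*-identityˡ y)))
                             (*-comm y x))

    coeff-p^[2+j]-b : ∀ j b → coeff (p ℕ.^ (2 ℕ.+ j)) b ≈ 0#
    coeff-p^[2+j]-b j b = trans (*-congʳ (*-congʳ (*-congʳ (μ-p^[2+k] j pp))))
                                (trans (*-congʳ (trans (*-congʳ (zeroˡ _)) (zeroˡ _))) (zeroˡ _))

    coeff-a-p^[2+j] : ∀ a j → coeff a (p ℕ.^ (2 ℕ.+ j)) ≈ 0#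
    coeff-a-p^[2+j] a j = trans (*-congʳ (*-congʳ (*-congˡ (μ-p^[2+k] j pp))))
                                (trans (*-congʳ (trans (*-congʳ (zeroʳ _)) (zeroˡ _))) (zeroˡ _))

    -- Jclosed r m is J(pʳ) at level p^(r+m). In the interior it equals G(r+1) - y G r and
    -- H r - x H(r+1) (E+yG≈G, E+xH≈H), which is what makes eSum and dSum telescope.
    F G H : ℕ → Carrier
    F r = K (p ℕ.^ r)
    G r = F r + - x * F (suc r)
    H r = F (suc r) + - y * F r

    Jclosed : ℕ → ℕ → Carrier
    Jclosed zero    zero    = F 0
    Jclosed zero    (suc m) = G 0
    Jclosed (suc r) zero    = H r
    Jclosed (suc r) (suc m) = (F (suc r) + - x * F (2 ℕ.+ r)) + (- y * F r + x * y * F (suc r))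

    term : ℕ → ℕ → ℕ → Carrier
    term r s t = coeff (p ℕ.^ s) (p ℕ.^ t) * K ((p ℕ.^ t ℕ.* p ℕ.^ r) div (p ℕ.^ s))

    term-at : ∀ {γ} s t r → coeff (p ℕ.^ s) (p ℕ.^ t) ≈ γ → term (s ℕ.+ r) s t ≈ γ * F (t ℕ.+ r)
    term-at s t r coeff≈γ = *-cong coeff≈γ (reflexive (≡.cong K (p^t*p^[s+r]-div-p^s t r s pp)))

    term-0-0 : ∀ r → term r 0 0 ≈ F r
    term-0-0 r = trans (term-at 0 0 r coeff-1-1) (*-identityˡ _)

    vanishˡ : ∀ r j t → term r (2 ℕ.+ j) t ≈ 0#
    vanishˡ r j t = trans (*-congʳ (coeff-p^[2+j]-b j _)) (zeroˡ _)

    vanishʳ : ∀ r s j → term r s (2 ℕ.+ j) ≈ 0#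
    vanishʳ r s j = trans (*-congʳ (coeff-a-p^[2+j] _ j)) (zeroˡ _)

    row-vanishes : ∀ r m j → sumOver (upTo m) (term r (2 ℕ.+ j)) ≈ 0#
    row-vanishes r m j = trans (Sum.fold-cong (upTo m) (λ {t} _ → vanishˡ r j t)) (Sum.fold-ε (upTo m))

    double-sum≈Jclosed : ∀ r m → sumOver (upTo (suc r)) (λ s → sumOver (upTo (suc m)) (term r s)) ≈ Jclosed r m
    double-sum≈Jclosed zero zero = trans (+-identityʳ _) (trans (+-identityʳ _) (term-0-0 0))
    double-sum≈Jclosed zero (suc m) = trans (+-identityʳ _) (trans (sum-upTo-2+ m _ (vanishʳ 0 0))
      (+-cong (term-0-0 0) (term-at 0 1 0 coeff-1-p)))
    double-sum≈Jclosed (suc r) zero = trans (sum-upTo-2+ r _ (row-vanishes (suc r) 1))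
      (+-cong (trans (+-identityʳ _) (term-0-0 (suc r))) (trans (+-identityʳ _) (term-at 1 0 r coeff-p-1)))
    double-sum≈Jclosed (suc r) (suc m) = trans (sum-upTo-2+ r _ (row-vanishes (suc r) (2 ℕ.+ m)))
      (+-cong (trans (sum-upTo-2+ m _ (vanishʳ (suc r) 0)) (+-cong (term-0-0 (suc r)) (term-at 0 1 (suc r) coeff-1-p)))
              (trans (sum-upTo-2+ m _ (vanishʳ (suc r) 1)) (+-cong (term-at 1 0 r coeff-p-1) (term-at 1 1 r coeff-p-p))))

    J-p^ : ∀ r m → J′ (p ℕ.^ (r ℕ.+ m)) K (p ℕ.^ r) ≈ Jclosed r m
    J-p^ r m = begin
      Σ∣ (p ℕ.^ r) (λ a → Σ∣ ((p ℕ.^ (r ℕ.+ m)) div (p ℕ.^ r)) (λ b → coeff a b * K ((b ℕ.* p ℕ.^ r) div a)))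
        ≡⟨ ≡.cong (λ h → Σ∣ (p ℕ.^ r) (λ a → Σ∣ h (λ b → coeff a b * K ((b ℕ.* p ℕ.^ r) div a)))) p^[r+m]-div-p^r ⟩
      Σ∣ (p ℕ.^ r) (λ a → Σ∣ (p ℕ.^ m) (λ b → coeff a b * K ((b ℕ.* p ℕ.^ r) div a)))
        ≈⟨ Sum.fold-divisors-p^k r pp _ ⟩
      sumOver (upTo (suc r)) (λ s → Σ∣ (p ℕ.^ m) (λ b → coeff (p ℕ.^ s) b * K ((b ℕ.* p ℕ.^ r) div (p ℕ.^ s))))
        ≈⟨ Sum.fold-cong (upTo (suc r)) (λ {s} _ → Sum.fold-divisors-p^k m pp _) ⟩
      sumOver (upTo (suc r)) (λ s → sumOver (upTo (suc m)) (term r s))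
        ≈⟨ double-sum≈Jclosed r m ⟩
      Jclosed r m ∎
      where
      p^[r+m]-div-p^r : (p ℕ.^ (r ℕ.+ m)) div (p ℕ.^ r) ≡ p ℕ.^ m
      p^[r+m]-div-p^r = ≡.trans (≡.cong (_div (p ℕ.^ r)) (ℕₚ.^-distribˡ-+-* p r m)) (m*n-div-m≡n _ (p^k>0 r pp))

    weight-p^-p^ : ∀ s t → weight (p ℕ.^ suc s) (p ℕ.^ suc t) ≈ 0#
    weight-p^-p^ s t = trans (*-congʳ (indicator-no (_ ℕ.≟ 1) (gcd[p^[1+s],p^[1+t]]≢1 s t pp))) (zeroˡ _)

    Jp : ℕ → ℕ → Carrier
    Jp n r = J′ (p ℕ.^ n) K (p ℕ.^ r)

    -- The terms of JSum with (d, e) = (1, pᵗ) and (d, e) = (p^(s+1), 1); all others have weight 0.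
    eSum : ℕ → ℕ → Carrier
    eSum n j = sumOver (upTo (suc j)) (λ t → ω₂ (p ℕ.^ t) * Jp n (j ℕ.∸ t))

    dSum : ℕ → ℕ → ℕ → Carrier
    dSum n i j = sumOver (upTo i) (λ s → ω₁ (p ℕ.^ suc s) * Jp n (j ℕ.+ suc s))

    JSum-p^ : ∀ n i j → JSum (p ℕ.^ n) (p ℕ.^ i) (p ℕ.^ j) K ≈ eSum n j + dSum n i j
    JSum-p^ n i j = begin
      Σ∣ (p ℕ.^ i) (λ d → Σ∣ (p ℕ.^ j) (λ e → weight d e * J′ (p ℕ.^ n) K ((p ℕ.^ j ℕ.* d) div e)))
        ≈⟨ Sum.fold-divisors-p^k i pp _ ⟩
      sumOver (upTo (suc i)) (λ s → Σ∣ (p ℕ.^ j) (λ e →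
        weight (p ℕ.^ s) e * J′ (p ℕ.^ n) K ((p ℕ.^ j ℕ.* p ℕ.^ s) div e)))
        ≈⟨ Sum.fold-cong (upTo (suc i)) (λ _ → Sum.fold-divisors-p^k j pp _) ⟩
      sumOver (upTo (suc i)) (λ s → sumOver (upTo (suc j)) (V s))
        ≈⟨ sum-upTo-suc i _ ⟩
      sumOver (upTo (suc j)) (V 0) + sumOver (upTo i) (λ s → sumOver (upTo (suc j)) (V (suc s)))
        ≈⟨ +-cong (Sum.fold-cong (upTo (suc j)) V-0) (Sum.fold-cong (upTo i) (λ {s} _ → V-suc s)) ⟩
      eSum n j + dSum n i j ∎
      where
      V : ℕ → ℕ → Carrier
      V s t = weight (p ℕ.^ s) (p ℕ.^ t) * J′ (p ℕ.^ n) K ((p ℕ.^ j ℕ.* p ℕ.^ s) div (p ℕ.^ t))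
      V-0 : ∀ {t} → t ∈ upTo (suc j) → V 0 t ≈ ω₂ (p ℕ.^ t) * Jp n (j ℕ.∸ t)
      V-0 {t} t∈ = *-cong (weight-1-e _) (reflexive (≡.cong (J′ (p ℕ.^ n) K)
        (≡.trans (≡.cong (_div (p ℕ.^ t)) p^j*1≡1*p^[t+[j∸t]]) (p^t*p^[s+r]-div-p^s 0 (j ℕ.∸ t) t pp))))
        where
        p^j*1≡1*p^[t+[j∸t]] : p ℕ.^ j ℕ.* 1 ≡ 1 ℕ.* p ℕ.^ (t ℕ.+ (j ℕ.∸ t))
        p^j*1≡1*p^[t+[j∸t]] = ≡.trans (ℕₚ.*-comm (p ℕ.^ j) 1)
          (≡.cong (λ k → 1 ℕ.* p ℕ.^ k) (≡.sym (ℕₚ.m+[n∸m]≡n (ℕₚ.≤-pred (∈-upTo⁻ t∈)))))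
      V-suc : ∀ s → sumOver (upTo (suc j)) (V (suc s)) ≈ ω₁ (p ℕ.^ suc s) * Jp n (j ℕ.+ suc s)
      V-suc s = trans (sum-upTo-suc j (V (suc s)))
        (trans (+-cong (*-cong (weight-d-1 _) (reflexive (≡.cong (J′ (p ℕ.^ n) K)
                          (≡.trans (n/1≡n _) (≡.sym (ℕₚ.^-distribˡ-+-* p j (suc s)))))))
                       (trans (Sum.fold-cong (upTo j) (λ {t} _ → trans (*-congʳ (weight-p^-p^ s t)) (zeroˡ _)))
                              (Sum.fold-ε (upTo j))))
               (+-identityʳ _))

    E : ℕ → Carrier
    E r = Jclosed (suc r) 1

    -- The semiring solver treats - x and - y as atoms; what it leaves over cancels by -‿inverse.
    E+yG≈G : ∀ r → E r + y * G r ≈ G (suc r)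
    E+yG≈G r = trans
      (solve 7 (λ a b c x y nx ny → ((a :+ nx :* b) :+ (ny :* c :+ x :* y :* a)) :+ y :* (c :+ nx :* a)
                                   := ((a :+ nx :* b) :+ (ny :+ y) :* c) :+ (x :+ nx) :* (y :* a))
             refl (F (suc r)) (F (2 ℕ.+ r)) (F r) x y (- x) (- y))
      (trans (+-cancel-zero (-‿inverseʳ x)) (+-cancel-zero (-‿inverseˡ y)))

    E+xH≈H : ∀ r → E r + x * H (suc r) ≈ H r
    E+xH≈H r = trans
      (solve 7 (λ a b c x y nx ny → ((a :+ nx :* b) :+ (ny :* c :+ x :* y :* a)) :+ x :* (b :+ ny :* a)
                                   := ((a :+ ny :* c) :+ (nx :+ x) :* b) :+ (y :+ ny) :* (x :* a))
             refl (F (suc r)) (F (2 ℕ.+ r)) (F r) x y (- x) (- y))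
      (trans (+-cancel-zero (-‿inverseʳ y)) (+-cancel-zero (-‿inverseˡ x)))

    H+yG≈[1-xy]F : ∀ r → H r + y * G r ≈ (1# - x * y) * F (suc r)
    H+yG≈[1-xy]F r = trans
      (solve 6 (λ a c x y nx ny → (a :+ ny :* c) :+ y :* (c :+ nx :* a)
                                := (con 1 :+ nx :* y) :* a :+ (ny :+ y) :* c)
             refl (F (suc r)) (F r) x y (- x) (- y))
      (trans (+-cancel-zero (-‿inverseˡ y)) (*-congʳ (+-congˡ (sym (-‿distribˡ-* x y)))))

    G+xH≈[1-xy]F : ∀ r → G r + x * H r ≈ (1# - x * y) * F r
    G+xH≈[1-xy]F r = trans
      (solve 6 (λ a c x y nx ny → (c :+ nx :* a) :+ x :* (a :+ ny :* c)
                                := (con 1 :+ x :* ny) :* c :+ (nx :+ x) :* a)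
             refl (F (suc r)) (F r) x y (- x) (- y))
      (trans (+-cancel-zero (-‿inverseˡ x)) (*-congʳ (+-congˡ (sym (-‿distribʳ-* x y)))))

    Jp-closed : ∀ {n} r m → r ℕ.+ m ≡ n → Jp n r ≈ Jclosed r m
    Jp-closed r m ≡.refl = J-p^ r m

    eSum-suc : ∀ n j → eSum n (suc j) ≈ Jp n (suc j) + y * eSum n j
    eSum-suc n j = trans (sum-upTo-suc (suc j) _)
      (+-cong (trans (*-congʳ (proj₁ ω₂-cm)) (*-identityˡ _))
              (trans (Sum.fold-cong (upTo (suc j)) (λ {t} _ →
                        trans (*-congʳ (ω-p^suc ω₂ ω₂-cm t)) (*-assoc _ _ _)))
                     (sym (*-distribˡ-sum (upTo (suc j)) y _))))

    dSum-suc : ∀ n i j → dSum n (suc i) j ≈ x * Jp n (suc j) + x * dSum n i (suc j)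
    dSum-suc n i j = trans (sum-upTo-suc i _)
      (+-cong (*-cong (ω-p ω₁) (reflexive (≡.cong (Jp n) (ℕₚ.+-comm j 1))))
              (trans (Sum.fold-cong (upTo i) (λ {s} _ →
                        trans (*-cong (ω-p^suc ω₁ ω₁-cm (suc s)) (reflexive (≡.cong (Jp n) (ℕₚ.+-suc j (suc s)))))
                              (*-assoc _ _ _)))
                     (sym (*-distribˡ-sum (upTo i) x _))))

    eSum-closed : ∀ n j m → j ℕ.+ suc m ≡ n → eSum n j ≈ G j
    eSum-closed n zero m 1+m≡n = trans (+-identityʳ _) (trans (*-congʳ (proj₁ ω₂-cm))
      (trans (*-identityˡ _) (Jp-closed 0 (suc m) 1+m≡n)))
    eSum-closed n (suc j) m j+1+m≡n = begin
      eSum n (suc j)              ≈⟨ eSum-suc n j ⟩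
      Jp n (suc j) + y * eSum n j ≈⟨ +-cong (Jp-closed (suc j) (suc m) j+1+m≡n)
                                            (*-congˡ (eSum-closed n j (suc m) j+2+m≡n)) ⟩
      E j + y * G j               ≈⟨ E+yG≈G j ⟩
      G (suc j)                   ∎
      where
      j+2+m≡n : j ℕ.+ suc (suc m) ≡ n
      j+2+m≡n = ≡.trans (ℕₚ.+-suc j (suc m)) j+1+m≡n

    eSum-top : ∀ k → eSum (suc k) (suc k) ≈ (1# - x * y) * F (suc k)
    eSum-top k = begin
      eSum (suc k) (suc k)                    ≈⟨ eSum-suc (suc k) k ⟩
      Jp (suc k) (suc k) + y * eSum (suc k) k ≈⟨ +-cong (Jp-closed (suc k) 0 (ℕₚ.+-identityʳ (suc k)))
                                                        (*-congˡ (eSum-closed (suc k) k 0 (ℕₚ.+-comm k 1))) ⟩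
      H k + y * G k                           ≈⟨ H+yG≈[1-xy]F k ⟩
      (1# - x * y) * F (suc k)                ∎

    dSum-closed : ∀ n i j → suc i ℕ.+ j ≡ n → dSum n (suc i) j ≈ x * H j
    dSum-closed n zero j 1+j≡n = begin
      dSum n 1 j                    ≈⟨ dSum-suc n 0 j ⟩
      x * Jp n (suc j) + x * 0#     ≈⟨ trans (+-congˡ (zeroʳ x)) (+-identityʳ _) ⟩
      x * Jp n (suc j)              ≈⟨ *-congˡ (Jp-closed (suc j) 0 (≡.trans (ℕₚ.+-identityʳ (suc j)) 1+j≡n)) ⟩
      x * H j                       ∎
    dSum-closed n (suc i) j 2+i+j≡n = begin
      dSum n (suc (suc i)) j                        ≈⟨ dSum-suc n (suc i) j ⟩
      x * Jp n (suc j) + x * dSum n (suc i) (suc j) ≈⟨ +-cong (*-congˡ (Jp-closed (suc j) (suc i) j+1+i+1≡n))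
                                                              (*-congˡ (dSum-closed n i (suc j) 1+i+j+1≡n)) ⟩
      x * E j + x * (x * H (suc j))                 ≈⟨ distribˡ x _ _ ⟨
      x * (E j + x * H (suc j))                     ≈⟨ *-congˡ (E+xH≈H j) ⟩
      x * H j                                       ∎
      where
      1+i+j+1≡n : suc i ℕ.+ suc j ≡ n
      1+i+j+1≡n = ≡.trans (ℕₚ.+-suc (suc i) j) 2+i+j≡n
      j+1+i+1≡n : suc j ℕ.+ suc i ≡ n
      j+1+i+1≡n = ≡.trans (ℕₚ.+-comm (suc j) (suc i)) 1+i+j+1≡n

    [1-xy]F≈eSum+dSum : ∀ k i j → i ℕ.+ j ≡ suc k → (1# - x * y) * F j ≈ eSum (suc k) j + dSum (suc k) i j
    [1-xy]F≈eSum+dSum k zero j ≡.refl = sym (trans (+-identityʳ _) (eSum-top k))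
    [1-xy]F≈eSum+dSum k (suc i) j 1+i+j≡1+k = begin
      (1# - x * y) * F j                      ≈⟨ G+xH≈[1-xy]F j ⟨
      G j + x * H j                           ≈⟨ +-cong (eSum-closed (suc k) j i (≡.trans (ℕₚ.+-comm j (suc i)) 1+i+j≡1+k))
                                                        (dSum-closed (suc k) i j 1+i+j≡1+k) ⟨
      eSum (suc k) j + dSum (suc k) (suc i) j ∎

  inversion-p^ : ∀ {p} k → Prime p → InversionAt (p ℕ.^ suc k)
  inversion-p^ {p} k pp K A B AB≡p^k
    with ∣p^k⇒≡p^i pp (suc k) (divides B (≡.trans (≡.sym AB≡p^k) (ℕₚ.*-comm A B)))
  ... | i , i≤1+k , ≡.refl
    with ≡.refl ← ℕₚ.*-cancelˡ-≡ B (p ℕ.^ (suc k ℕ.∸ i)) (p ℕ.^ i) {{ℕ.>-nonZero (p^k>0 i pp)}}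
                    (≡.trans AB≡p^k (≡.trans (≡.cong (p ℕ.^_) (≡.sym (ℕₚ.m+[n∸m]≡n i≤1+k)))
                                              (ℕₚ.^-distribˡ-+-* p i (suc k ℕ.∸ i)))) = begin
    eulerFactor (p ℕ.^ suc k) * F j
      ≈⟨ *-congʳ (Product.fold-primeDivisors-p^k k pp _) ⟩
    (1# - x * y) * F j
      ≈⟨ [1-xy]F≈eSum+dSum k i j (ℕₚ.m+[n∸m]≡n i≤1+k) ⟩
    eSum (suc k) j + dSum (suc k) i j
      ≈⟨ JSum-p^ (suc k) i j ⟨
    JSum (p ℕ.^ suc k) (p ℕ.^ i) (p ℕ.^ j) K ∎
    where
    open PrimePower pp K
    j = suc k ℕ.∸ i

  inversion-1 : InversionAt 1
  inversion-1 K A B AB≡1 with ≡.refl ← ℕₚ.m*n≡1⇒m≡1 A B AB≡1 | ≡.refl ← ℕₚ.m*n≡1⇒n≡1 A B AB≡1 =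
    trans (*-identityˡ (K 1)) (sym (trans (+-identityʳ _) (trans (+-identityʳ _)
      (trans (*-cong (trans (weight-1-e 1) (proj₁ ω₂-cm)) J-1) (*-identityˡ _)))))
    where
    J-1 : J′ 1 K 1 ≈ K 1
    J-1 = trans (+-identityʳ _) (trans (+-identityʳ _) (trans (*-congʳ coeff-1-1) (*-identityˡ _)))

  inversion : ∀ L → 0 < L → InversionAt L
  inversion = coprime-induction InversionAt inversion-1 inversion-p^ inversion-coprime-*

  eulerFactor-inverse : ∀ L inv → (∀ p → Prime p → p ∣ L → (1# - ω₁ p * ω₂ p) * inv p ≈ 1#) →
    prodOver (primeDivisors L) inv * eulerFactor L ≈ 1#
  eulerFactor-inverse L inv inv-spec = begin
    prodOver (primeDivisors L) inv * eulerFactor L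
      ≈⟨ Product.fold-∙ (primeDivisors L) inv _ ⟨
    prodOver (primeDivisors L) (λ p → inv p * (1# - ω₁ p * ω₂ p))
      ≈⟨ Product.fold-cong (primeDivisors L) (λ {p} p∈ → let (pp , p∣L) = ∈-primeDivisors⁻ L p∈ in
                                                trans (*-comm _ _) (inv-spec p pp p∣L)) ⟩
    prodOver (primeDivisors L) (λ _ → 1#)
      ≈⟨ Product.fold-ε (primeDivisors L) ⟩
    1# ∎

  JSum≈filtered : ∀ L A B K → JSum L A B K ≈
    Σ∣ A (λ d → sumOver (filter (λ e → gcd d e ℕ.≟ 1) (divisors B))
                 (λ e → ω₁ d * ω₂ e * J′ L K ((B ℕ.* d) div e)))
  JSum≈filtered L A B K = Sum.fold-cong (divisors A) (λ {d} _ → sym (trans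
    (sum-filter (λ e → gcd d e ℕ.≟ 1) (divisors B) _)
    (Sum.fold-cong (divisors B) (λ _ → sym (*-assoc _ _ _)))))

lemma7p2 : ∀ {c ℓ} (R : CommutativeRing c ℓ) (L : ℕ) → 1 ≤ L →
    let open Arith R in
    (ω₁ ω₂ : ℕ → Carrier) → CompletelyMultiplicative ω₁ → CompletelyMultiplicative ω₂ →
    (inv : ℕ → Carrier) →
    (∀ p → Prime p → p ∣ L → (1# - ω₁ p * ω₂ p) * inv p ≈ 1#) →
    (K : ℕ → Carrier) → (A B : ℕ) → A ℕ.* B ≡ L →
    K B ≈ prodOver (primeDivisors L) inv
          * Σ∣ A (λ d → sumOver (filter (λ e → gcd d e ℕ.≟ 1) (divisors B))
                   (λ e → ω₁ d * ω₂ e * J L ω₁ ω₂ K ((B ℕ.* d) div e)))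
lemma7p2 R L 0<L ω₁ ω₂ ω₁-cm ω₂-cm inv inv-spec K A B AB≡L = begin
  K B                                                   ≈⟨ *-identityˡ (K B) ⟨
  1# * K B                                              ≈⟨ *-congʳ (eulerFactor-inverse L inv inv-spec) ⟨
  (prodOver (primeDivisors L) inv * eulerFactor L) * K B ≈⟨ *-assoc _ _ _ ⟩
  prodOver (primeDivisors L) inv * (eulerFactor L * K B) ≈⟨ *-congˡ (inversion L 0<L K A B AB≡L) ⟩
  prodOver (primeDivisors L) inv * JSum L A B K          ≈⟨ *-congˡ (JSum≈filtered L A B K) ⟩
  prodOver (primeDivisors L) inv * Σ∣ A (λ d → sumOver (filter (λ e → gcd d e ℕ.≟ 1) (divisors B))
                                           (λ e → ω₁ d * ω₂ e * J L ω₁ ω₂ K ((B ℕ.* d) div e))) ∎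
  where
  open Arith R
  open Inversion R ω₁ ω₂ ω₁-cm ω₂-cm
  open import Relation.Binary.Reasoning.Setoid setoid
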